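{- Consider one-dimensional Internal Diffusion Limited Aggregation on $\mathbb{Z}$, defined as follows. Initially the set of occupied sites is $\{0\}$. Particles are released one at a time at the origin; each particle performs a simple symmetric random walk on $\mathbb{Z}$ (at each step moving $+1$ or $-1$ with probability $\tfrac12$ each, independently, like tossing a fair coin) until it first reaches an unoccupied site, at which point it stops, that site becomes occupied, and the next particle is released at the origin. After $n-1$ particles have settled, the set of occupied sites is an interval of $n$ integers containing $0$. For $n \ge 1$ and $0 \le k \le n-1$, let $P(n,k)$ denote the probability that, at the moment when there are exactly $n$ occupied sites, exactly $k$ of the occupied sites are positive integers. Then for all $n \geq 1$ and $0 \leq k \leq n-1$, \[ P(n,k) = \frac{\left\langle {n \atop k} \right\rangle}{n!}, \] where $\left\langle {n \atop k} \right\rangle$ is the Eulerian number.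
   Context: For $n \ge 1$ and $0 \le k \le n-1$, the Eulerian number $\left\langle {n \atop k} \right\rangle$ is the number of permutations of $\{1,2,\dots,n\}$ with exactly $k$ descents (a descent of $w$ is an index $i$ with $w(i) > w(i+1)$). -}

module Defs where

open import Data.Nat as ℕ using (ℕ; zero; suc; _∸_; _!)
open import Data.Nat.Properties using (_!≢0)
open import Data.Integer as ℤ using (ℤ; +_)
open import Data.Rational as ℚ using (ℚ; ½; 0ℚ; 1ℚ)
open import Data.Fin as Fin using (Fin; toℕ)
open import Data.Fin.Properties using () renaming (_≟_ to _≟ᶠ_)
open import Data.Vec using (Vec; []; _∷_)
open import Data.List using (List; []; _∷_; concatMap; map; length; filter)
open import Data.Bool using (Bool; true; false; _∧_; if_then_else_)
open import Relation.Nullary.Decidable using (does)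
open import Relation.Binary.PropositionalEquality using (_≡_)

-- A permutation of {1,…,n} is represented (order-isomorphically) by its
-- one-line notation: a vector w(0),…,w(n-1) of elements of Fin n with
-- pairwise distinct entries.

allFin′ : (n : ℕ) → List (Fin n)
allFin′ zero = []
allFin′ (suc n) = Fin.zero ∷ map Fin.suc (allFin′ n)

words : (m n : ℕ) → List (Vec (Fin n) m)
words zero n = [] ∷ []
words (suc m) n = concatMap (λ x → map (x ∷_) (words m n)) (allFin′ n)

notIn : {n m : ℕ} → Fin n → Vec (Fin n) m → Bool
notIn x [] = true
notIn x (y ∷ ys) = (if does (x ≟ᶠ y) then false else true) ∧ notIn x ys

distinct : {n m : ℕ} → Vec (Fin n) m → Bool
distinct [] = true
distinct (x ∷ xs) = notIn x xs ∧ distinct xs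

descents : {n m : ℕ} → Vec (Fin n) m → ℕ
descents [] = 0
descents (x ∷ []) = 0
descents (x ∷ y ∷ ys) =
  (if toℕ y ℕ.<ᵇ toℕ x then 1 else 0) ℕ.+ descents (y ∷ ys)

permutations : (n : ℕ) → List (Vec (Fin n) n)
permutations n = filter (λ w → Data.Bool._≟_ (distinct w) true) (words n n)
  where import Data.Bool

eulerian : ℕ → ℕ → ℕ
eulerian n k =
  length (filter (λ w → descents w ℕ.≟ k) (permutations n))

eulerianRatio : ℕ → ℕ → ℚ
eulerianRatio n k = (+ eulerian n k) ℚ./ (n !)
  where instance _ = n !≢0

-- The occupied set is always an interval {-a, …, b} (a, b : ℕ).
-- exitRight t a b x : probability that a simple symmetric random walk
-- started at x stops (= first reaches an unoccupied site) at the site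
-- b+1, and does so within at most t steps.  exitLeft: same for -(a+1).

exitRight : (t a b : ℕ) → ℤ → ℚ
exitRight t a b x with does (ℤ.+ b ℤ.<? x) | does (x ℤ.<? ℤ.- (+ a))
... | true  | _     = 1ℚ
... | false | true  = 0ℚ
exitRight zero a b x | false | false = 0ℚ
exitRight (suc t) a b x | false | false =
  ½ ℚ.* exitRight t a b (x ℤ.+ + 1) ℚ.+ ½ ℚ.* exitRight t a b (x ℤ.- + 1)

exitLeft : (t a b : ℕ) → ℤ → ℚ
exitLeft t a b x with does (x ℤ.<? ℤ.- (+ a)) | does (ℤ.+ b ℤ.<? x)
... | true  | _     = 1ℚ
... | false | true  = 0ℚ
exitLeft zero a b x | false | false = 0ℚ
exitLeft (suc t) a b x | false | false =
  ½ ℚ.* exitLeft t a b (x ℤ.+ + 1) ℚ.+ ½ ℚ.* exitLeft t a b (x ℤ.- + 1)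

-- idla t j b : probability that after j particles have been released
-- (starting from the occupied set {0}) every one of them settled within
-- t steps of its walk and the occupied set is {-(j-b), …, b}, i.e.
-- exactly b occupied sites are positive (it is 0 when b > j).
idla : (t j b : ℕ) → ℚ
idla t zero zero = 1ℚ
idla t zero (suc b) = 0ℚ
idla t (suc j) zero =
  idla t j zero ℚ.* exitLeft t j zero (+ 0)
idla t (suc j) (suc b) =
  idla t j (suc b) ℚ.* exitLeft t (j ∸ suc b) (suc b) (+ 0)
  ℚ.+ idla t j b ℚ.* exitRight t (j ∸ b) b (+ 0)

-- While k of the n occupied sites are positive the occupied set is {k + 1 − n, …, k}, and the next
-- particle leaves it on the left with the gambler's-ruin probability (k + 1)/(n + 1) and on the right
-- with probability (n − k)/(n + 1).  Hence the limiting probabilities satisfy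
--   P(n + 1, k) = (k + 1)/(n + 1) · P(n, k) + (n + 1 − k)/(n + 1) · P(n, k − 1),
-- which after multiplication by (n + 1)! is the recurrence of the Eulerian numbers.  The permutation
-- count obeys the same recurrence: inserting a new largest letter into a word with d descents keeps
-- d descents in d + 1 of its slots and creates one more in the others.
-- In idla the walks are cut off after t steps.  A walk on {0, …, N} started at i survives t steps
-- with probability at most i (N − i)/t (Markov's inequality for the exit time), so every truncated
-- exit probability lies below its limit by O(1/t), and these errors propagate linearly through the
-- recursion.

module Submission where

open import Algebra.Bundles using (CommutativeMonoid)
import Algebra.Properties.CommutativeSemigroup as CommSemigroupProperties
open import Data.Bool as Bool using (Bool; true; false; if_then_else_; _∧_)
import Data.Bool.Properties as Bool
open import Data.Empty using (⊥-elim)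
open import Data.Fin as Fin using (Fin; toℕ; inject₁; fromℕ; lower₁)
import Data.Fin.Properties as Fin
open import Data.Integer as ℤ using (ℤ; -[1+_])
import Data.Integer.Properties as ℤ
open import Data.List as List using (List; []; _∷_; _++_; concatMap; filter; length)
open import Data.Nat.Base as ℕ using (ℕ; zero; suc; z≤n; s≤s; _∸_; _!)
open import Data.Nat.Combinatorics using (_C_; nCn≡1; nCk+nC[k+1]≡[n+1]C[k+1])
import Data.Nat.Properties as ℕ
open import Data.Product using (∃; ∃₂; _×_; _,_; proj₁; proj₂)
import Data.Product.Properties as Product
open import Data.Rational as ℚ using (ℚ; 0ℚ; 1ℚ; ½; toℚᵘ; mkℚ; ∣_∣)
import Data.Rational.Properties as ℚ
open import Data.Rational.Solver using (module +-*-Solver)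
import Data.Rational.Unnormalised as ℚᵘ
import Data.Rational.Unnormalised.Properties as ℚᵘ
open import Data.Vec as Vec using (Vec; []; _∷_; insertAt)
import Data.Vec.Properties as Vec
open import Data.Vec.Relation.Unary.All using (All; []; _∷_; universal)
open import Data.Vec.Relation.Unary.All.Properties using (map⁺)
open import Function using (_∘_)
open import Relation.Binary.Definitions using (DecidableEquality)
open import Relation.Binary.PropositionalEquality
open import Relation.Nullary using (Dec; yes; no; ¬_; does)
open import Relation.Nullary.Decidable using (dec-true; dec-false)

open import Defs

module EulerianNumbers where
  open import Data.Nat.Base using (_+_; _*_; _≤_; _<_)
  open import Data.Nat.Tactic.RingSolver using (solve-∀)

  module + = CommSemigroupProperties ℕ.+-commutativeSemigroup

  eulerianRec : ℕ → ℕ → ℕ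
  eulerianRec zero    zero    = 1
  eulerianRec zero    (suc k) = 0
  eulerianRec (suc n) zero    = eulerianRec n zero
  eulerianRec (suc n) (suc k) = suc (suc k) * eulerianRec n (suc k) + (n ∸ k) * eulerianRec n k

  eulerianRec-vanishes : ∀ n k → n ≤ suc k → eulerianRec n (suc k) ≡ 0
  eulerianRec-vanishes zero    k _ = refl
  eulerianRec-vanishes (suc n) k (s≤s n≤k)
    rewrite eulerianRec-vanishes n k (ℕ.m≤n⇒m≤1+n n≤k) | ℕ.m≤n⇒m∸n≡0 n≤k | ℕ.*-zeroʳ k = refl

  -- Finite sums and counting

  sumOver : {A : Set} → List A → (A → ℕ) → ℕ
  sumOver []       f = 0
  sumOver (x ∷ xs) f = f x + sumOver xs f

  syntax sumOver xs (λ x → e) = Σ[ x ∈ xs ] e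

  module _ {A : Set} where

    Σ-cong : ∀ (xs : List A) {f g : A → ℕ} → (∀ x → f x ≡ g x) → Σ[ x ∈ xs ] f x ≡ Σ[ x ∈ xs ] g x
    Σ-cong []       f≗g = refl
    Σ-cong (x ∷ xs) f≗g = cong₂ _+_ (f≗g x) (Σ-cong xs f≗g)

    Σ-zero : ∀ (xs : List A) {f : A → ℕ} → (∀ x → f x ≡ 0) → Σ[ x ∈ xs ] f x ≡ 0
    Σ-zero []       f≗0 = refl
    Σ-zero (x ∷ xs) f≗0 rewrite f≗0 x = Σ-zero xs f≗0

    Σ-++ : ∀ (xs ys : List A) (f : A → ℕ) → Σ[ x ∈ xs ++ ys ] f x ≡ Σ[ x ∈ xs ] f x + Σ[ y ∈ ys ] f y
    Σ-++ []       ys f = refl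
    Σ-++ (x ∷ xs) ys f rewrite Σ-++ xs ys f = sym (ℕ.+-assoc (f x) _ _)

    Σ-+ : ∀ (xs : List A) (f g : A → ℕ) → Σ[ x ∈ xs ] (f x + g x) ≡ Σ[ x ∈ xs ] f x + Σ[ x ∈ xs ] g x
    Σ-+ []       f g = refl
    Σ-+ (x ∷ xs) f g rewrite Σ-+ xs f g = +.interchange (f x) (g x) _ _

    Σ-*ˡ : ∀ (xs : List A) c (f : A → ℕ) → Σ[ x ∈ xs ] (c * f x) ≡ c * Σ[ x ∈ xs ] f x
    Σ-*ˡ []       c f = sym (ℕ.*-zeroʳ c)
    Σ-*ˡ (x ∷ xs) c f rewrite Σ-*ˡ xs c f = sym (ℕ.*-distribˡ-+ c (f x) _)

    Σ-*ʳ : ∀ (xs : List A) c (f : A → ℕ) → Σ[ x ∈ xs ] (f x * c) ≡ Σ[ x ∈ xs ] f x * c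
    Σ-*ʳ xs c f = begin
      Σ[ x ∈ xs ] (f x * c)  ≡⟨ Σ-cong xs (λ x → ℕ.*-comm (f x) c) ⟩
      Σ[ x ∈ xs ] (c * f x)  ≡⟨ Σ-*ˡ xs c f ⟩
      c * Σ[ x ∈ xs ] f x    ≡⟨ ℕ.*-comm c _ ⟩
      Σ[ x ∈ xs ] f x * c    ∎
      where open ≡-Reasoning

    Σ-map : ∀ {B : Set} (h : B → A) (ys : List B) (f : A → ℕ) → Σ[ x ∈ List.map h ys ] f x ≡ Σ[ y ∈ ys ] f (h y)
    Σ-map h []       f = refl
    Σ-map h (y ∷ ys) f = cong (f (h y) +_) (Σ-map h ys f)

    Σ-concatMap : ∀ {B : Set} (h : B → List A) (ys : List B) (f : A → ℕ) →
      Σ[ x ∈ concatMap h ys ] f x ≡ Σ[ y ∈ ys ] Σ[ x ∈ h y ] f x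
    Σ-concatMap h []       f = refl
    Σ-concatMap h (y ∷ ys) f =
      trans (Σ-++ (h y) (concatMap h ys) f) (cong (Σ[ x ∈ h y ] f x +_) (Σ-concatMap h ys f))

  Σ-comm : ∀ {A B : Set} (xs : List A) (ys : List B) (f : A → B → ℕ) →
    Σ[ x ∈ xs ] Σ[ y ∈ ys ] f x y ≡ Σ[ y ∈ ys ] Σ[ x ∈ xs ] f x y
  Σ-comm []       ys f = sym (Σ-zero ys (λ _ → refl))
  Σ-comm (x ∷ xs) ys f rewrite Σ-comm xs ys f = sym (Σ-+ ys (f x) (λ y → Σ[ x′ ∈ xs ] f x′ y))

  Σ-grid : ∀ {A B C : Set} (g : A → B → C) (xs : List A) (ys : List B) (f : C → ℕ) →
    Σ[ z ∈ concatMap (λ x → List.map (g x) ys) xs ] f z ≡ Σ[ x ∈ xs ] Σ[ y ∈ ys ] f (g x y)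
  Σ-grid g xs ys f = trans (Σ-concatMap _ xs f) (Σ-cong xs (λ x → Σ-map (g x) ys f))

  𝟙 : {P : Set} → Dec P → ℕ
  𝟙 P? = if does P? then 1 else 0

  𝟙-yes : ∀ {P : Set} (P? : Dec P) → P → 𝟙 P? ≡ 1
  𝟙-yes (yes _) p = refl
  𝟙-yes (no ¬p) p = ⊥-elim (¬p p)

  𝟙-no : ∀ {P : Set} (P? : Dec P) → ¬ P → 𝟙 P? ≡ 0
  𝟙-no (yes p) ¬p = ⊥-elim (¬p p)
  𝟙-no (no _)  ¬p = refl

  𝟙-cong : ∀ {P Q : Set} (P? : Dec P) (Q? : Dec Q) → (P → Q) → (Q → P) → 𝟙 P? ≡ 𝟙 Q?
  𝟙-cong (yes p) Q? P→Q Q→P = sym (𝟙-yes Q? (P→Q p))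
  𝟙-cong (no ¬p) Q? P→Q Q→P = sym (𝟙-no Q? (¬p ∘ Q→P))

  𝟙-× : ∀ {P Q R : Set} (R? : Dec R) (P? : Dec P) (Q? : Dec Q) → (R → P × Q) → (P → Q → R) → 𝟙 R? ≡ 𝟙 P? * 𝟙 Q?
  𝟙-× R? (yes p) (yes q) R→P×Q P→Q→R = 𝟙-yes R? (P→Q→R p q)
  𝟙-× R? (yes p) (no ¬q) R→P×Q P→Q→R = 𝟙-no R? (¬q ∘ proj₂ ∘ R→P×Q)
  𝟙-× R? (no ¬p) Q?      R→P×Q P→Q→R = 𝟙-no R? (¬p ∘ proj₁ ∘ R→P×Q)

  split-by : ∀ (b : Bool) n → n ≡ (if b then n else 0) + (if b then 0 else n)
  split-by true  n = sym (ℕ.+-identityʳ n)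
  split-by false n = refl

  𝟙-≡-true : ∀ {b} → 𝟙 (b Bool.≟ true) ≢ 0 → b ≡ true
  𝟙-≡-true {true}  _ = refl
  𝟙-≡-true {false} 𝟙≢0 = ⊥-elim (𝟙≢0 refl)

  *-𝟙-≡ : ∀ (f : ℕ → ℕ) {d k} (d≟k : Dec (d ≡ k)) → f d * 𝟙 d≟k ≡ f k * 𝟙 d≟k
  *-𝟙-≡ f (yes refl) = refl
  *-𝟙-≡ f {d} {k} (no _) = trans (ℕ.*-zeroʳ (f d)) (sym (ℕ.*-zeroʳ (f k)))

  module _ {A : Set} {P : A → Set} (P? : ∀ x → Dec (P x)) where

    length-filter : ∀ xs → length (filter P? xs) ≡ Σ[ x ∈ xs ] 𝟙 (P? x)
    length-filter []       = refl
    length-filter (x ∷ xs) with does (P? x)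
    ... | true  = cong suc (length-filter xs)
    ... | false = length-filter xs

    Σ-filter : ∀ xs (f : A → ℕ) → Σ[ x ∈ filter P? xs ] f x ≡ Σ[ x ∈ xs ] (𝟙 (P? x) * f x)
    Σ-filter []       f = refl
    Σ-filter (x ∷ xs) f with does (P? x)
    ... | true  = cong₂ _+_ (sym (ℕ.+-identityʳ (f x))) (Σ-filter xs f)
    ... | false = Σ-filter xs f

  module _ {A : Set} (_≟_ : DecidableEquality A) where

    count : A → List A → ℕ
    count a xs = Σ[ x ∈ xs ] 𝟙 (x ≟ a)

    Enumerates : List A → Set
    Enumerates xs = ∀ a → count a xs ≡ 1

    Σ-select-absent : ∀ xs a (f : A → ℕ) → count a xs ≡ 0 → Σ[ x ∈ xs ] (𝟙 (x ≟ a) * f x) ≡ 0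
    Σ-select-absent []       a f _ = refl
    Σ-select-absent (x ∷ xs) a f #a≡0 with x ≟ a
    ... | yes _ = ⊥-elim (ℕ.1+n≢0 #a≡0)
    ... | no  _ = Σ-select-absent xs a f #a≡0

    Σ-select : ∀ xs a (f : A → ℕ) → count a xs ≡ 1 → Σ[ x ∈ xs ] (𝟙 (x ≟ a) * f x) ≡ f a
    Σ-select []       a f ()
    Σ-select (x ∷ xs) a f #a≡1 with x ≟ a
    ... | yes refl = begin
      f x + 0 + Σ[ x′ ∈ xs ] (𝟙 (x′ ≟ x) * f x′)
        ≡⟨ cong (f x + 0 +_) (Σ-select-absent xs x f (ℕ.suc-injective #a≡1)) ⟩
      f x + 0 + 0
        ≡⟨ trans (ℕ.+-identityʳ _) (ℕ.+-identityʳ _) ⟩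
      f x ∎
      where open ≡-Reasoning
    ... | no _ = Σ-select xs a f #a≡1

  module _ {A B : Set} (_≟ᴬ_ : DecidableEquality A) (_≟ᴮ_ : DecidableEquality B) where

    Σ-reindex : ∀ (xs : List A) (ys : List B) → Enumerates _≟ᴬ_ xs → Enumerates _≟ᴮ_ ys →
      (ψ : B → A) → (∀ {y y′} → ψ y ≡ ψ y′ → y ≡ y′) → (f : A → ℕ) →
      (∀ a → f a ≢ 0 → ∃ λ y → ψ y ≡ a) →
      Σ[ x ∈ xs ] f x ≡ Σ[ y ∈ ys ] f (ψ y)
    Σ-reindex xs ys enum-xs enum-ys ψ ψ-injective f support⊆image = sym (begin
      Σ[ y ∈ ys ] f (ψ y)
        ≡⟨ Σ-cong ys (λ y → sym (Σ-select _≟ᴬ_ xs (ψ y) f (enum-xs (ψ y)))) ⟩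
      Σ[ y ∈ ys ] Σ[ x ∈ xs ] (𝟙 (x ≟ᴬ ψ y) * f x)
        ≡⟨ Σ-comm ys xs (λ y x → 𝟙 (x ≟ᴬ ψ y) * f x) ⟩
      Σ[ x ∈ xs ] Σ[ y ∈ ys ] (𝟙 (x ≟ᴬ ψ y) * f x)
        ≡⟨ Σ-cong xs (λ x → Σ-*ʳ ys (f x) (λ y → 𝟙 (x ≟ᴬ ψ y))) ⟩
      Σ[ x ∈ xs ] (Σ[ y ∈ ys ] 𝟙 (x ≟ᴬ ψ y) * f x)
        ≡⟨ Σ-cong xs preimages ⟩
      Σ[ x ∈ xs ] f x ∎)
      where
      open ≡-Reasoning
      preimages : ∀ x → Σ[ y ∈ ys ] 𝟙 (x ≟ᴬ ψ y) * f x ≡ f x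
      preimages x with f x ℕ.≟ 0
      ... | yes fx≡0 rewrite fx≡0 = ℕ.*-zeroʳ (Σ[ y ∈ ys ] 𝟙 (x ≟ᴬ ψ y))
      ... | no  fx≢0 with support⊆image x fx≢0
      ... | y₀ , refl = begin
        Σ[ y ∈ ys ] 𝟙 (ψ y₀ ≟ᴬ ψ y) * f (ψ y₀)
          ≡⟨ cong (_* f (ψ y₀)) (Σ-cong ys λ y →
               𝟙-cong (ψ y₀ ≟ᴬ ψ y) (y ≟ᴮ y₀) (sym ∘ ψ-injective) (cong ψ ∘ sym)) ⟩
        count _≟ᴮ_ y₀ ys * f (ψ y₀)
          ≡⟨ cong (_* f (ψ y₀)) (enum-ys y₀) ⟩
        1 * f (ψ y₀)
          ≡⟨ ℕ.*-identityˡ _ ⟩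
        f (ψ y₀) ∎

  module _ {A B C : Set}
           (_≟ᴬ_ : DecidableEquality A) (_≟ᴮ_ : DecidableEquality B) (_≟ᶜ_ : DecidableEquality C) where

    enumerates-grid : ∀ (xs : List A) (ys : List B) → Enumerates _≟ᴬ_ xs → Enumerates _≟ᴮ_ ys →
      (g : A → B → C) → (∀ {x y x′ y′} → g x y ≡ g x′ y′ → x ≡ x′ × y ≡ y′) → (∀ c → ∃₂ λ x y → g x y ≡ c) →
      Enumerates _≟ᶜ_ (concatMap (λ x → List.map (g x) ys) xs)
    enumerates-grid xs ys enum-xs enum-ys g g-injective g-surjective c with g-surjective c
    ... | a , b , refl = begin
      count _≟ᶜ_ (g a b) (concatMap (λ x → List.map (g x) ys) xs)
        ≡⟨ Σ-grid g xs ys _ ⟩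
      Σ[ x ∈ xs ] Σ[ y ∈ ys ] 𝟙 (g x y ≟ᶜ g a b)
        ≡⟨ Σ-cong xs (λ x → Σ-cong ys λ y → 𝟙-× (g x y ≟ᶜ g a b) (x ≟ᴬ a) (y ≟ᴮ b) g-injective (cong₂ g)) ⟩
      Σ[ x ∈ xs ] Σ[ y ∈ ys ] (𝟙 (x ≟ᴬ a) * 𝟙 (y ≟ᴮ b))
        ≡⟨ Σ-cong xs (λ x → trans (Σ-*ˡ ys (𝟙 (x ≟ᴬ a)) _) (cong (𝟙 (x ≟ᴬ a) *_) (enum-ys b))) ⟩
      Σ[ x ∈ xs ] (𝟙 (x ≟ᴬ a) * 1)
        ≡⟨ trans (Σ-*ʳ xs 1 _) (cong (_* 1) (enum-xs a)) ⟩
      1 ∎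
      where open ≡-Reasoning

  _≟ʷ_ : ∀ {N m} → DecidableEquality (Vec (Fin N) m)
  _≟ʷ_ = Vec.≡-dec Fin._≟_

  Σ-allFin′-suc : ∀ n (f : Fin (suc n) → ℕ) →
    Σ[ i ∈ allFin′ (suc n) ] f i ≡ f Fin.zero + Σ[ i ∈ allFin′ n ] f (Fin.suc i)
  Σ-allFin′-suc n f = cong (f Fin.zero +_) (Σ-map Fin.suc (allFin′ n) f)

  enumerates-allFin′ : ∀ n → Enumerates Fin._≟_ (allFin′ n)
  enumerates-allFin′ (suc n) Fin.zero =
    cong suc (trans (Σ-map Fin.suc (allFin′ n) _) (Σ-zero (allFin′ n) (λ _ → refl)))
  enumerates-allFin′ (suc n) (Fin.suc i) = begin
    Σ[ j ∈ List.map Fin.suc (allFin′ n) ] 𝟙 (j Fin.≟ Fin.suc i)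
      ≡⟨ Σ-map Fin.suc (allFin′ n) _ ⟩
    Σ[ j ∈ allFin′ n ] 𝟙 (Fin.suc j Fin.≟ Fin.suc i)
      ≡⟨ Σ-cong (allFin′ n) (λ j →
           𝟙-cong (Fin.suc j Fin.≟ Fin.suc i) (j Fin.≟ i) Fin.suc-injective (cong Fin.suc)) ⟩
    count Fin._≟_ i (allFin′ n)
      ≡⟨ enumerates-allFin′ n i ⟩
    1 ∎
    where open ≡-Reasoning

  enumerates-words : ∀ m N → Enumerates _≟ʷ_ (words m N)
  enumerates-words zero    N [] = refl
  enumerates-words (suc m) N =
    enumerates-grid Fin._≟_ _≟ʷ_ _≟ʷ_ (allFin′ N) (words m N) (enumerates-allFin′ N) (enumerates-words m N)
      _∷_ Vec.∷-injective λ { (x ∷ v) → x , v , refl }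

  module ∧ = CommSemigroupProperties (CommutativeMonoid.commutativeSemigroup Bool.∧-commutativeMonoid)

  -- the letter comparison inside Defs.notIn
  differ : ∀ {n} → Fin n → Fin n → Bool
  differ x y = if does (x Fin.≟ y) then false else true

  module _ {n : ℕ} where

    differ-sym : (x y : Fin n) → differ x y ≡ differ y x
    differ-sym x y with x Fin.≟ y | y Fin.≟ x
    ... | yes _   | yes _   = refl
    ... | no  _   | no  _   = refl
    ... | yes x≡y | no  y≢x = ⊥-elim (y≢x (sym x≡y))
    ... | no  x≢y | yes y≡x = ⊥-elim (x≢y (sym y≡x))

    differ-self : (x : Fin n) → differ x x ≡ false
    differ-self x with x Fin.≟ x
    ... | yes _   = refl
    ... | no  x≢x = ⊥-elim (x≢x refl)

    differ⇒≢ : ∀ {x y : Fin n} → differ x y ≡ true → x ≢ y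
    differ⇒≢ {x} {y} differ≡true x≡y with x Fin.≟ y
    differ⇒≢ () x≡y | yes _
    ... | no x≢y = x≢y x≡y

    ≢⇒differ : ∀ {x y : Fin n} → x ≢ y → differ x y ≡ true
    ≢⇒differ {x} {y} x≢y with x Fin.≟ y
    ... | yes x≡y = ⊥-elim (x≢y x≡y)
    ... | no  _   = refl

    differ-inject₁ : (x y : Fin n) → differ (inject₁ x) (inject₁ y) ≡ differ x y
    differ-inject₁ x y with x Fin.≟ y | inject₁ x Fin.≟ inject₁ y
    ... | yes _   | yes _   = refl
    ... | no  _   | no  _   = refl
    ... | yes x≡y | no  x≢y = ⊥-elim (x≢y (cong inject₁ x≡y))
    ... | no  x≢y | yes x≡y = ⊥-elim (x≢y (Fin.inject₁-injective x≡y))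

  ∧-≡-true : ∀ {a b} → a ∧ b ≡ true → a ≡ true × b ≡ true
  ∧-≡-true {true} {true} _ = refl , refl

  module _ {n : ℕ} where

    notIn-insertAt : ∀ {m} (y x : Fin n) (w : Vec (Fin n) m) i →
      notIn y (insertAt w i x) ≡ differ y x ∧ notIn y w
    notIn-insertAt y x w       Fin.zero    = refl
    notIn-insertAt y x (z ∷ w) (Fin.suc i) rewrite notIn-insertAt y x w i =
      ∧.x∙yz≈y∙xz (differ y z) (differ y x) (notIn y w)

    notIn-insertAt-self : ∀ {m} (x : Fin n) (w : Vec (Fin n) m) i → notIn x (insertAt w i x) ≡ false
    notIn-insertAt-self x w i rewrite notIn-insertAt x x w i | differ-self x = refl

    distinct-insertAt : ∀ {m} (x : Fin n) (w : Vec (Fin n) m) i →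
      distinct (insertAt w i x) ≡ notIn x w ∧ distinct w
    distinct-insertAt x w       Fin.zero    = refl
    distinct-insertAt x (z ∷ w) (Fin.suc i)
      rewrite notIn-insertAt z x w i | distinct-insertAt x w i | differ-sym z x =
        ∧.interchange (differ x z) (notIn z w) (notIn x w) (distinct w)

    notIn-map-inject₁ : ∀ {m} (x : Fin n) (u : Vec (Fin n) m) →
      notIn (inject₁ x) (Vec.map inject₁ u) ≡ notIn x u
    notIn-map-inject₁ x []      = refl
    notIn-map-inject₁ x (y ∷ u) = cong₂ _∧_ (differ-inject₁ x y) (notIn-map-inject₁ x u)

    distinct-map-inject₁ : ∀ {m} (u : Vec (Fin n) m) → distinct (Vec.map inject₁ u) ≡ distinct u
    distinct-map-inject₁ []      = refl
    distinct-map-inject₁ (y ∷ u) = cong₂ _∧_ (notIn-map-inject₁ y u) (distinct-map-inject₁ u)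

    descents-map-inject₁ : ∀ {m} (u : Vec (Fin n) m) → descents (Vec.map inject₁ u) ≡ descents u
    descents-map-inject₁ []          = refl
    descents-map-inject₁ (x ∷ [])    = refl
    descents-map-inject₁ (x ∷ y ∷ u) = cong₂ _+_
      (cong₂ (λ a b → if b ℕ.<ᵇ a then 1 else 0) (Fin.toℕ-inject₁ x) (Fin.toℕ-inject₁ y))
      (descents-map-inject₁ (y ∷ u))

    fromℕ-notIn-map-inject₁ : ∀ {m} (u : Vec (Fin n) m) → notIn (fromℕ n) (Vec.map inject₁ u) ≡ true
    fromℕ-notIn-map-inject₁ []      = refl
    fromℕ-notIn-map-inject₁ (y ∷ u) =
      cong₂ _∧_ (≢⇒differ (Fin.fromℕ≢inject₁ {i = y})) (fromℕ-notIn-map-inject₁ u)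

    fromℕ-notIn⇒map-inject₁ : ∀ {m} (v : Vec (Fin (suc n)) m) → notIn (fromℕ n) v ≡ true →
      ∃ λ u → Vec.map inject₁ u ≡ v
    fromℕ-notIn⇒map-inject₁ []      _ = [] , refl
    fromℕ-notIn⇒map-inject₁ (x ∷ v) fromℕ∉x∷v
      with ∧-≡-true fromℕ∉x∷v
    ... | fromℕ≢x , fromℕ∉v with fromℕ-notIn⇒map-inject₁ v fromℕ∉v
    ... | u , refl = lower₁ x n≢x ∷ u , cong (_∷ Vec.map inject₁ u) (Fin.inject₁-lower₁ x n≢x)
      where
      n≢x : n ≢ toℕ x
      n≢x n≡x = differ⇒≢ fromℕ≢x (Fin.toℕ-injective (trans (Fin.toℕ-fromℕ n) n≡x))

    map-inject₁-injective : ∀ {m} {u w : Vec (Fin n) m} → Vec.map inject₁ u ≡ Vec.map inject₁ w → u ≡ w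
    map-inject₁-injective {u = []}    {[]}    _ = refl
    map-inject₁-injective {u = x ∷ u} {y ∷ w} eq with Vec.∷-injective eq
    ... | x≡y , u≡w = cong₂ _∷_ (Fin.inject₁-injective x≡y) (map-inject₁-injective u≡w)

    insertAt-injective : ∀ {m} (x : Fin n) {w w′ : Vec (Fin n) m} {i j} → notIn x w ≡ true → notIn x w′ ≡ true →
      insertAt w i x ≡ insertAt w′ j x → w ≡ w′ × i ≡ j
    insertAt-injective x {i = Fin.zero} {Fin.zero} _ _ eq = Vec.∷-injectiveʳ eq , refl
    insertAt-injective x {w′ = z ∷ w′} {Fin.zero} {Fin.suc j} _ x∉z∷w′ eq =
      ⊥-elim (differ⇒≢ (proj₁ (∧-≡-true x∉z∷w′)) (Vec.∷-injectiveˡ eq))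
    insertAt-injective x {w = z ∷ w} {i = Fin.suc i} {Fin.zero} x∉z∷w _ eq =
      ⊥-elim (differ⇒≢ (proj₁ (∧-≡-true x∉z∷w)) (sym (Vec.∷-injectiveˡ eq)))
    insertAt-injective x {z ∷ w} {z′ ∷ w′} {Fin.suc i} {Fin.suc j} x∉z∷w x∉z′∷w′ eq
      with Vec.∷-injective eq
    ... | z≡z′ , eq′ with insertAt-injective x (proj₂ (∧-≡-true x∉z∷w)) (proj₂ (∧-≡-true x∉z′∷w′)) eq′
    ... | w≡w′ , i≡j = cong₂ _∷_ z≡z′ w≡w′ , cong Fin.suc i≡j

  insertMax : ∀ {N m} → Vec (Fin N) m × Fin (suc m) → Vec (Fin (suc N)) (suc m)
  insertMax {N} (u , i) = insertAt (Vec.map inject₁ u) i (fromℕ N)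

  insertMax-injective : ∀ {N m} {p q : Vec (Fin N) m × Fin (suc m)} → insertMax p ≡ insertMax q → p ≡ q
  insertMax-injective {N} {p = u , i} {w , j} eq
    with insertAt-injective (fromℕ N) (fromℕ-notIn-map-inject₁ u) (fromℕ-notIn-map-inject₁ w) eq
  ... | u≡w , refl = cong (_, i) (map-inject₁-injective u≡w)

  insertMax-surjective : ∀ {N m} (v : Vec (Fin (suc N)) (suc m)) →
    distinct v ≡ true → notIn (fromℕ N) v ≡ false → ∃ λ p → insertMax p ≡ v
  insertMax-surjective {N} (x ∷ v) distinct-x∷v fromℕ∈x∷v with x Fin.≟ fromℕ N
  ... | yes refl with fromℕ-notIn⇒map-inject₁ v (proj₁ (∧-≡-true distinct-x∷v))
  ... | u , refl = (u , Fin.zero) , refl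
  insertMax-surjective {N} (x ∷ []) _ fromℕ∈x∷v | no x≢fromℕ
    rewrite ≢⇒differ (x≢fromℕ ∘ sym) with fromℕ∈x∷v
  ... | ()
  insertMax-surjective {N} (x ∷ v@(_ ∷ _)) distinct-x∷v fromℕ∈x∷v | no x≢fromℕ
    rewrite ≢⇒differ (x≢fromℕ ∘ sym)
    with insertMax-surjective v (proj₂ (∧-≡-true {notIn x v} distinct-x∷v)) fromℕ∈x∷v
  ... | (u , i) , eq = (lower₁ x N≢x ∷ u , Fin.suc i) , cong₂ _∷_ (Fin.inject₁-lower₁ x N≢x) eq
    where
    N≢x : N ≢ toℕ x
    N≢x N≡x = x≢fromℕ (Fin.toℕ-injective (trans (sym N≡x) (sym (Fin.toℕ-fromℕ N))))

  <⇒<ᵇ≡true : ∀ {m n} → m < n → (m ℕ.<ᵇ n) ≡ true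
  <⇒<ᵇ≡true {zero}  {suc n} _         = refl
  <⇒<ᵇ≡true {suc m} {suc n} (s≤s m<n) = <⇒<ᵇ≡true m<n

  ≤⇒<ᵇ≡false : ∀ {m n} → n ≤ m → (m ℕ.<ᵇ n) ≡ false
  ≤⇒<ᵇ≡false {m}     {zero}  _         = refl
  ≤⇒<ᵇ≡false {suc m} {suc n} (s≤s n≤m) = ≤⇒<ᵇ≡false n≤m

  if-1-0≤1 : ∀ b → (if b then 1 else 0) ≤ 1
  if-1-0≤1 true  = ℕ.≤-refl
  if-1-0≤1 false = z≤n

  descents-≤ : ∀ {n m} (w : Vec (Fin n) m) → descents w ≤ m
  descents-≤ []          = z≤n
  descents-≤ (x ∷ [])    = z≤n
  descents-≤ (x ∷ y ∷ w) = ℕ.+-mono-≤ (if-1-0≤1 (toℕ y ℕ.<ᵇ toℕ x)) (descents-≤ (y ∷ w))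

  descent-slots-step : ∀ (g : ℕ → ℕ) {c} d m S → c ≤ 1 → d ≤ suc m →
    g (c + suc d) + S ≡ suc d * g (c + d) + (suc m ∸ d) * g (c + suc d) →
    g (suc (c + d)) + (g (suc d) + S) ≡ suc (c + d) * g (c + d) + (suc (suc m) ∸ (c + d)) * g (suc (c + d))
  descent-slots-step g d m S z≤n d≤1+m ih = begin
    g (suc d) + (g (suc d) + S)
      ≡⟨ cong (g (suc d) +_) ih ⟩
    g (suc d) + (suc d * g d + (suc m ∸ d) * g (suc d))
      ≡⟨ +.x∙yz≈y∙xz (g (suc d)) (suc d * g d) _ ⟩
    suc d * g d + suc (suc m ∸ d) * g (suc d)
      ≡⟨ cong (λ k → suc d * g d + k * g (suc d)) (ℕ.+-∸-assoc 1 d≤1+m) ⟨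
    suc d * g d + (suc (suc m) ∸ d) * g (suc d) ∎
    where open ≡-Reasoning
  descent-slots-step g d m S (s≤s z≤n) _ ih = begin
    g (suc (suc d)) + (g (suc d) + S)
      ≡⟨ +.x∙yz≈y∙xz (g (suc (suc d))) (g (suc d)) S ⟩
    g (suc d) + (g (suc (suc d)) + S)
      ≡⟨ cong (g (suc d) +_) ih ⟩
    g (suc d) + (suc d * g (suc d) + (suc m ∸ d) * g (suc (suc d)))
      ≡⟨ ℕ.+-assoc (g (suc d)) _ _ ⟨
    suc (suc d) * g (suc d) + (suc m ∸ d) * g (suc (suc d)) ∎
    where open ≡-Reasoning

  -- Inserting a letter larger than all others right after a descent or at the end keeps the number d
  -- of descents, anywhere else it adds one; there are d + 1 slots of the first kind among m + 1.
  Σ-descents-insertAt-max : ∀ {n m} (M : Fin n) (w : Vec (Fin n) m) → All (λ y → toℕ y < toℕ M) w →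
    (g : ℕ → ℕ) → Σ[ i ∈ allFin′ (suc m) ] g (descents (insertAt w i M))
      ≡ suc (descents w) * g (descents w) + (m ∸ descents w) * g (suc (descents w))
  Σ-descents-insertAt-max M [] [] g = sym (ℕ.+-identityʳ _)
  Σ-descents-insertAt-max M (y ∷ []) (y<M ∷ []) g
    rewrite <⇒<ᵇ≡true y<M | ≤⇒<ᵇ≡false (ℕ.<⇒≤ y<M) =
      trans (ℕ.+-comm (g 1) _) (cong (g 0 + 0 +_) (sym (ℕ.+-identityʳ (g 1))))
  -- The slots after the first two are those of h ∷ w, behind the c ∈ {0, 1} descents between y and h.
  Σ-descents-insertAt-max {m = suc (suc m)} M (y ∷ h ∷ w) (y<M ∷ h<M ∷ w<M) g = begin
    Σ[ i ∈ allFin′ (suc (suc (suc m))) ] g (descents (insertAt (y ∷ h ∷ w) i M))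
      ≡⟨ trans (Σ-allFin′-suc (suc (suc m)) (λ i → g (descents (insertAt (y ∷ h ∷ w) i M))))
           (cong (g (descents (M ∷ y ∷ h ∷ w)) +_)
             (Σ-allFin′-suc (suc m) (λ i → g (descents (y ∷ insertAt (h ∷ w) i M))))) ⟩
    g (descents (M ∷ y ∷ h ∷ w)) + (g (descents (y ∷ M ∷ h ∷ w)) + S)
      ≡⟨ cong₂ (λ a b → g a + (g b + S)) M∷y∷h∷w-descents y∷M∷h∷w-descents ⟩
    g (suc (c + d)) + (g (suc d) + S)
      ≡⟨ descent-slots-step g d m S (if-1-0≤1 (toℕ h ℕ.<ᵇ toℕ y)) (descents-≤ (h ∷ w))
           (shift (Σ-descents-insertAt-max M (h ∷ w) (h<M ∷ w<M) (g ∘ (c +_)))) ⟩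
    suc (c + d) * g (c + d) + (suc (suc m) ∸ (c + d)) * g (suc (c + d))
      ∎
    where
    open ≡-Reasoning
    c = if toℕ h ℕ.<ᵇ toℕ y then 1 else 0
    d = descents (h ∷ w)
    S = Σ[ i ∈ allFin′ (suc m) ] g (c + descents (h ∷ insertAt w i M))
    M∷y∷h∷w-descents : descents (M ∷ y ∷ h ∷ w) ≡ suc (c + d)
    M∷y∷h∷w-descents rewrite <⇒<ᵇ≡true y<M = refl
    y∷M∷h∷w-descents : descents (y ∷ M ∷ h ∷ w) ≡ suc d
    y∷M∷h∷w-descents rewrite ≤⇒<ᵇ≡false (ℕ.<⇒≤ y<M) | <⇒<ᵇ≡true h<M = refl
    M∷h∷w-descents : descents (M ∷ h ∷ w) ≡ suc d
    M∷h∷w-descents rewrite <⇒<ᵇ≡true h<M = refl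
    shift : Σ[ i ∈ allFin′ (suc (suc m)) ] g (c + descents (insertAt (h ∷ w) i M))
              ≡ suc d * g (c + d) + (suc m ∸ d) * g (c + suc d) →
            g (c + suc d) + S ≡ suc d * g (c + d) + (suc m ∸ d) * g (c + suc d)
    shift ih = begin
      g (c + suc d) + S
        ≡⟨ cong (λ e → g (c + e) + S) M∷h∷w-descents ⟨
      g (c + descents (M ∷ h ∷ w)) + S
        ≡⟨ Σ-allFin′-suc (suc m) (λ i → g (c + descents (insertAt (h ∷ w) i M))) ⟨
      Σ[ i ∈ allFin′ (suc (suc m)) ] g (c + descents (insertAt (h ∷ w) i M))
        ≡⟨ ih ⟩
      suc d * g (c + d) + (suc m ∸ d) * g (c + suc d) ∎

  maxInsertions : ℕ → ℕ → ℕ → ℕ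
  maxInsertions m d k = suc d * 𝟙 (d ℕ.≟ k) + (m ∸ d) * 𝟙 (suc d ℕ.≟ k)

  -- Counting words with distinct letters by descents

  𝟙-distinct : ∀ {N m} → Vec (Fin N) m → ℕ
  𝟙-distinct w = 𝟙 (distinct w Bool.≟ true)

  χ : ∀ {N m} → ℕ → Vec (Fin N) m → ℕ
  χ k w = 𝟙-distinct w * 𝟙 (descents w ℕ.≟ k)

  injWordCount : ℕ → ℕ → ℕ → ℕ
  injWordCount N m k = Σ[ w ∈ words m N ] χ k w

  eulerian≡injWordCount : ∀ n k → eulerian n k ≡ injWordCount n n k
  eulerian≡injWordCount n k =
    trans (length-filter (λ w → descents w ℕ.≟ k) (permutations n))
          (Σ-filter (λ w → distinct w Bool.≟ true) (words n n) (λ w → 𝟙 (descents w ℕ.≟ k)))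

  _≟ᵖ_ : ∀ {N m} → DecidableEquality (Vec (Fin N) m × Fin (suc m))
  _≟ᵖ_ = Product.≡-dec _≟ʷ_ Fin._≟_

  wordsWithSlot : ∀ m N → List (Vec (Fin N) m × Fin (suc m))
  wordsWithSlot m N = concatMap (λ u → List.map (u ,_) (allFin′ (suc m))) (words m N)

  enumerates-wordsWithSlot : ∀ m N → Enumerates _≟ᵖ_ (wordsWithSlot m N)
  enumerates-wordsWithSlot m N =
    enumerates-grid _≟ʷ_ Fin._≟_ _≟ᵖ_ (words m N) (allFin′ (suc m))
      (enumerates-words m N) (enumerates-allFin′ (suc m))
      _,_ (λ { refl → refl , refl }) (λ { (u , i) → u , i , refl })

  inject₁<fromℕ : ∀ {N} (y : Fin N) → toℕ (inject₁ y) < toℕ (fromℕ N)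
  inject₁<fromℕ {N} y = subst₂ _<_ (sym (Fin.toℕ-inject₁ y)) (sym (Fin.toℕ-fromℕ N)) (Fin.toℕ<n y)

  module _ (N m k : ℕ) where

    private
      top : Fin (suc N)
      top = fromℕ N

    Σ-avoiding-top : Σ[ v ∈ words (suc m) (suc N) ] (if notIn top v then χ k v else 0)
                     ≡ injWordCount N (suc m) k
    Σ-avoiding-top = trans
      (Σ-reindex _≟ʷ_ _≟ʷ_ (words (suc m) (suc N)) (words (suc m) N)
        (enumerates-words (suc m) (suc N)) (enumerates-words (suc m) N)
        (Vec.map inject₁) map-inject₁-injective _ support)
      (Σ-cong (words (suc m) N) restrict)
      where
      support : ∀ v → (if notIn top v then χ k v else 0) ≢ 0 → ∃ λ u → Vec.map inject₁ u ≡ v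
      support v χv≢0 with notIn top v in top∉v
      ... | true  = fromℕ-notIn⇒map-inject₁ v top∉v
      ... | false = ⊥-elim (χv≢0 refl)
      restrict : ∀ u → (if notIn top (Vec.map inject₁ u) then χ k (Vec.map inject₁ u) else 0) ≡ χ k u
      restrict u rewrite fromℕ-notIn-map-inject₁ u | distinct-map-inject₁ u | descents-map-inject₁ u = refl

    Σ-containing-top : Σ[ v ∈ words (suc m) (suc N) ] (if notIn top v then 0 else χ k v)
                       ≡ Σ[ u ∈ words m N ] (𝟙-distinct u * maxInsertions m (descents u) k)
    Σ-containing-top = begin
      Σ[ v ∈ words (suc m) (suc N) ] F v
        ≡⟨ Σ-reindex _≟ʷ_ _≟ᵖ_ (words (suc m) (suc N)) (wordsWithSlot m N)
             (enumerates-words (suc m) (suc N)) (enumerates-wordsWithSlot m N)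
             insertMax insertMax-injective F support ⟩
      Σ[ p ∈ wordsWithSlot m N ] F (insertMax p)
        ≡⟨ Σ-grid _,_ (words m N) (allFin′ (suc m)) (F ∘ insertMax) ⟩
      Σ[ u ∈ words m N ] Σ[ i ∈ allFin′ (suc m) ] F (insertMax (u , i))
        ≡⟨ Σ-cong (words m N) slots ⟩
      Σ[ u ∈ words m N ] (𝟙-distinct u * maxInsertions m (descents u) k) ∎
      where
      open ≡-Reasoning
      F : Vec (Fin (suc N)) (suc m) → ℕ
      F v = if notIn top v then 0 else χ k v
      support : ∀ v → F v ≢ 0 → ∃ λ p → insertMax p ≡ v
      support v Fv≢0 with notIn top v in top∈v
      ... | true  = ⊥-elim (Fv≢0 refl)
      ... | false = insertMax-surjective v (𝟙-≡-true (λ 𝟙≡0 → Fv≢0 (cong (_* 𝟙 (descents v ℕ.≟ k)) 𝟙≡0))) top∈v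
      descentsAfter : Vec (Fin N) m → Fin (suc m) → ℕ
      descentsAfter u i = descents (insertAt (Vec.map inject₁ u) i top)
      weight : ∀ u i → F (insertMax (u , i)) ≡ 𝟙-distinct u * 𝟙 (descentsAfter u i ℕ.≟ k)
      weight u i rewrite notIn-insertAt-self top (Vec.map inject₁ u) i
                       | distinct-insertAt top (Vec.map inject₁ u) i
                       | fromℕ-notIn-map-inject₁ u | distinct-map-inject₁ u = refl
      slots : ∀ u → Σ[ i ∈ allFin′ (suc m) ] F (insertMax (u , i)) ≡ 𝟙-distinct u * maxInsertions m (descents u) k
      slots u = begin
        Σ[ i ∈ allFin′ (suc m) ] F (insertMax (u , i))
          ≡⟨ Σ-cong (allFin′ (suc m)) (weight u) ⟩
        Σ[ i ∈ allFin′ (suc m) ] (𝟙-distinct u * 𝟙 (descentsAfter u i ℕ.≟ k))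
          ≡⟨ Σ-*ˡ (allFin′ (suc m)) (𝟙-distinct u) (λ i → 𝟙 (descentsAfter u i ℕ.≟ k)) ⟩
        𝟙-distinct u * Σ[ i ∈ allFin′ (suc m) ] 𝟙 (descentsAfter u i ℕ.≟ k)
          ≡⟨ cong (𝟙-distinct u *_) (Σ-descents-insertAt-max top (Vec.map inject₁ u)
               (map⁺ (universal inject₁<fromℕ u)) (λ d → 𝟙 (d ℕ.≟ k))) ⟩
        𝟙-distinct u * maxInsertions m (descents (Vec.map inject₁ u)) k
          ≡⟨ cong (λ d → 𝟙-distinct u * maxInsertions m d k) (descents-map-inject₁ u) ⟩
        𝟙-distinct u * maxInsertions m (descents u) k ∎

  injWordCount-suc : ∀ N m k → injWordCount (suc N) (suc m) k
    ≡ injWordCount N (suc m) k + Σ[ u ∈ words m N ] (𝟙-distinct u * maxInsertions m (descents u) k)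
  injWordCount-suc N m k = begin
    Σ[ v ∈ words (suc m) (suc N) ] χ k v
      ≡⟨ Σ-cong (words (suc m) (suc N)) (λ v → split-by (notIn (fromℕ N) v) (χ k v)) ⟩
    Σ[ v ∈ words (suc m) (suc N) ]
      ((if notIn (fromℕ N) v then χ k v else 0) + (if notIn (fromℕ N) v then 0 else χ k v))
      ≡⟨ Σ-+ (words (suc m) (suc N)) _ _ ⟩
    _ ≡⟨ cong₂ _+_ (Σ-avoiding-top N m k) (Σ-containing-top N m k) ⟩
    _ ∎
    where open ≡-Reasoning

  maxInsertions-zero : ∀ m d → maxInsertions m d 0 ≡ 𝟙 (d ℕ.≟ 0)
  maxInsertions-zero m zero    rewrite ℕ.*-zeroʳ m = refl
  maxInsertions-zero m (suc d) rewrite ℕ.*-zeroʳ (m ∸ suc d) | ℕ.*-zeroʳ d = refl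

  maxInsertions-suc : ∀ m d k →
    maxInsertions m d (suc k) ≡ suc (suc k) * 𝟙 (d ℕ.≟ suc k) + (m ∸ k) * 𝟙 (d ℕ.≟ k)
  maxInsertions-suc m d k = cong₂ _+_ (*-𝟙-≡ suc (d ℕ.≟ suc k)) (begin
    (m ∸ d) * 𝟙 (suc d ℕ.≟ suc k)
      ≡⟨ cong ((m ∸ d) *_) (𝟙-cong (suc d ℕ.≟ suc k) (d ℕ.≟ k) ℕ.suc-injective (cong suc)) ⟩
    (m ∸ d) * 𝟙 (d ℕ.≟ k)
      ≡⟨ *-𝟙-≡ (m ∸_) (d ℕ.≟ k) ⟩
    (m ∸ k) * 𝟙 (d ℕ.≟ k) ∎)
    where open ≡-Reasoning

  distrib-weights : ∀ a s e t e′ → a * (s * e + t * e′) ≡ s * (a * e) + t * (a * e′)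
  distrib-weights = solve-∀

  pascal-weights : ∀ c₀ c₁ s e t e′ →
    c₁ * (s * e + t * e′) + (s * (c₀ * e) + t * (c₀ * e′)) ≡ (c₀ + c₁) * (s * e + t * e′)
  pascal-weights = solve-∀

  -- Splitting the words over Fin (suc N) by whether they contain the largest letter gives Pascal's
  -- rule for the binomial factor and the Eulerian recurrence for the descents.
  injWordCount≡C*eulerianRec : ∀ N m k → injWordCount N m k ≡ (N C m) * eulerianRec m k
  injWordCount≡C*eulerianRec N       zero    zero    = refl
  injWordCount≡C*eulerianRec N       zero    (suc k) = sym (ℕ.*-zeroʳ (N C 0))
  injWordCount≡C*eulerianRec zero    (suc m) k       = refl
  injWordCount≡C*eulerianRec (suc N) (suc m) zero    = begin
    injWordCount (suc N) (suc m) 0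
      ≡⟨ injWordCount-suc N m 0 ⟩
    injWordCount N (suc m) 0 + Σ[ u ∈ words m N ] (𝟙-distinct u * maxInsertions m (descents u) 0)
      ≡⟨ cong (injWordCount N (suc m) 0 +_) (Σ-cong (words m N) λ u →
           cong (𝟙-distinct u *_) (maxInsertions-zero m (descents u))) ⟩
    injWordCount N (suc m) 0 + injWordCount N m 0
      ≡⟨ cong₂ _+_ (injWordCount≡C*eulerianRec N (suc m) 0) (injWordCount≡C*eulerianRec N m 0) ⟩
    (N C suc m) * eulerianRec m 0 + (N C m) * eulerianRec m 0
      ≡⟨ trans (ℕ.*-distribʳ-+ (eulerianRec m 0) (N C m) (N C suc m)) (ℕ.+-comm ((N C m) * eulerianRec m 0) _) ⟨
    (N C m + N C suc m) * eulerianRec m 0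
      ≡⟨ cong (_* eulerianRec m 0) (nCk+nC[k+1]≡[n+1]C[k+1] N m) ⟩
    (suc N C suc m) * eulerianRec (suc m) 0 ∎
    where open ≡-Reasoning
  injWordCount≡C*eulerianRec (suc N) (suc m) (suc k) = begin
    injWordCount (suc N) (suc m) (suc k)
      ≡⟨ injWordCount-suc N m (suc k) ⟩
    injWordCount N (suc m) (suc k) + Σ[ u ∈ words m N ] (𝟙-distinct u * maxInsertions m (descents u) (suc k))
      ≡⟨ cong (injWordCount N (suc m) (suc k) +_) new-slots ⟩
    injWordCount N (suc m) (suc k) + (suc (suc k) * injWordCount N m (suc k) + (m ∸ k) * injWordCount N m k)
      ≡⟨ cong₂ _+_ (injWordCount≡C*eulerianRec N (suc m) (suc k))
           (cong₂ _+_ (cong (suc (suc k) *_) (injWordCount≡C*eulerianRec N m (suc k)))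
                      (cong ((m ∸ k) *_) (injWordCount≡C*eulerianRec N m k))) ⟩
    (N C suc m) * eulerianRec (suc m) (suc k)
      + (suc (suc k) * ((N C m) * eulerianRec m (suc k)) + (m ∸ k) * ((N C m) * eulerianRec m k))
      ≡⟨ pascal-weights (N C m) (N C suc m) (suc (suc k)) (eulerianRec m (suc k)) (m ∸ k) (eulerianRec m k) ⟩
    (N C m + N C suc m) * eulerianRec (suc m) (suc k)
      ≡⟨ cong (_* eulerianRec (suc m) (suc k)) (nCk+nC[k+1]≡[n+1]C[k+1] N m) ⟩
    (suc N C suc m) * eulerianRec (suc m) (suc k) ∎
    where
    open ≡-Reasoning
    new-slots : Σ[ u ∈ words m N ] (𝟙-distinct u * maxInsertions m (descents u) (suc k))
                ≡ suc (suc k) * injWordCount N m (suc k) + (m ∸ k) * injWordCount N m k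
    new-slots = begin
      Σ[ u ∈ words m N ] (𝟙-distinct u * maxInsertions m (descents u) (suc k))
        ≡⟨ Σ-cong (words m N) (λ u → trans
             (cong (𝟙-distinct u *_) (maxInsertions-suc m (descents u) k))
             (distrib-weights (𝟙-distinct u) (suc (suc k)) (𝟙 (descents u ℕ.≟ suc k))
                                              (m ∸ k) (𝟙 (descents u ℕ.≟ k)))) ⟩
      Σ[ u ∈ words m N ] (suc (suc k) * χ (suc k) u + (m ∸ k) * χ k u)
        ≡⟨ Σ-+ (words m N) _ _ ⟩
      Σ[ u ∈ words m N ] (suc (suc k) * χ (suc k) u) + Σ[ u ∈ words m N ] ((m ∸ k) * χ k u)
        ≡⟨ cong₂ _+_ (Σ-*ˡ (words m N) (suc (suc k)) (χ (suc k))) (Σ-*ˡ (words m N) (m ∸ k) (χ k)) ⟩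
      suc (suc k) * injWordCount N m (suc k) + (m ∸ k) * injWordCount N m k ∎

  eulerian≡eulerianRec : ∀ n k → eulerian n k ≡ eulerianRec n k
  eulerian≡eulerianRec n k = begin
    eulerian n k               ≡⟨ eulerian≡injWordCount n k ⟩
    injWordCount n n k         ≡⟨ injWordCount≡C*eulerianRec n n k ⟩
    (n C n) * eulerianRec n k  ≡⟨ cong (_* eulerianRec n k) (nCn≡1 n) ⟩
    1 * eulerianRec n k        ≡⟨ ℕ.*-identityˡ _ ⟩
    eulerianRec n k            ∎
    where open ≡-Reasoning

module IdlaLimit where
  open import Data.Integer using (+_)
  open import Data.Rational using (_+_; _*_; _-_; -_; _≤_; _<_; _/_)
  open import Data.Rational.Properties using (≤-refl; ≤-trans; ≤-reflexive; <⇒≤; positive⁻¹;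
    +-mono-≤; +-monoʳ-≤; +-monoˡ-≤; +-identityˡ; +-identityʳ; +-inverseʳ;
    *-zeroˡ; *-zeroʳ; *-identityˡ; *-identityʳ; *-comm; *-assoc)
  open EulerianNumbers using (eulerianRec; eulerianRec-vanishes; eulerian≡eulerianRec)

  open +-*-Solver using (solve; _:=_; _:+_; _:*_; _:-_; :-_; con)
  open import Data.Integer.Tactic.RingSolver using (solve-∀)

  ι : ℕ → ℚ
  ι zero    = 0ℚ
  ι (suc n) = ι n + 1ℚ

  ι-+ : ∀ m n → ι (m ℕ.+ n) ≡ ι m + ι n
  ι-+ zero    n = sym (+-identityˡ (ι n))
  ι-+ (suc m) n rewrite ι-+ m n = lemma (ι m) (ι n)
    where
    lemma : ∀ x y → x + y + 1ℚ ≡ x + 1ℚ + y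
    lemma = solve 2 (λ x y → x :+ y :+ con 1ℚ := x :+ con 1ℚ :+ y) refl

  ι-* : ∀ m n → ι (m ℕ.* n) ≡ ι m * ι n
  ι-* zero    n = sym (*-zeroˡ (ι n))
  ι-* (suc m) n rewrite ι-+ n (m ℕ.* n) | ι-* m n = lemma (ι m) (ι n)
    where
    lemma : ∀ x y → y + x * y ≡ (x + 1ℚ) * y
    lemma = solve 2 (λ x y → y :+ x :* y := (x :+ con 1ℚ) :* y) refl

  0≤ι : ∀ n → 0ℚ ≤ ι n
  0≤ι zero    = ≤-refl
  0≤ι (suc n) = ℚ.+-mono-≤ (0≤ι n) (<⇒≤ (positive⁻¹ 1ℚ))

  0<ι-suc : ∀ n → 0ℚ < ι (suc n)
  0<ι-suc n = ℚ.+-mono-≤-< (0≤ι n) (positive⁻¹ 1ℚ)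

  ι-mono-≤ : ∀ {m n} → m ℕ.≤ n → ι m ≤ ι n
  ι-mono-≤ {m} m≤n with ℕ.m≤n⇒∃[o]m+o≡n m≤n
  ... | o , refl rewrite ι-+ m o = ≤-trans (≤-reflexive (sym (+-identityʳ (ι m)))) (+-monoʳ-≤ (ι m) (0≤ι o))

  toℚᵘ-ι : ∀ n → toℚᵘ (ι n) ℚᵘ.≃ ℚᵘ.mkℚᵘ (+ n) 0
  toℚᵘ-ι zero    = ℚᵘ.*≡* refl
  toℚᵘ-ι (suc n) = begin
    toℚᵘ (ι n + 1ℚ)               ≈⟨ ℚ.toℚᵘ-homo-+ (ι n) 1ℚ ⟩
    toℚᵘ (ι n) ℚᵘ.+ toℚᵘ 1ℚ       ≈⟨ ℚᵘ.+-congˡ (toℚᵘ 1ℚ) (toℚᵘ-ι n) ⟩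
    ℚᵘ.mkℚᵘ (+ n) 0 ℚᵘ.+ toℚᵘ 1ℚ  ≈⟨ ℚᵘ.*≡* (lemma (+ n)) ⟩
    ℚᵘ.mkℚᵘ (+ suc n) 0           ∎
    where
    open ℚᵘ.≃-Reasoning
    lemma : ∀ x → (x ℤ.* + 1 ℤ.+ + 1 ℤ.* + 1) ℤ.* + 1 ≡ (+ 1 ℤ.+ x) ℤ.* (+ 1 ℤ.* + 1)
    lemma = solve-∀

  ι-/ : ∀ p q .{{_ : ℕ.NonZero q}} → (+ p / q) * ι q ≡ ι p
  ι-/ p (suc q) = ℚ.toℚᵘ-injective (begin
    toℚᵘ ((+ p / suc q) * ι (suc q))
      ≈⟨ ℚ.toℚᵘ-homo-* (+ p / suc q) (ι (suc q)) ⟩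
    toℚᵘ (+ p / suc q) ℚᵘ.* toℚᵘ (ι (suc q))
      ≈⟨ ℚᵘ.*-cong (ℚ.toℚᵘ-fromℚᵘ (ℚᵘ.mkℚᵘ (+ p) q)) (toℚᵘ-ι (suc q)) ⟩
    ℚᵘ.mkℚᵘ (+ p) q ℚᵘ.* ℚᵘ.mkℚᵘ (+ suc q) 0
      ≈⟨ ℚᵘ.*≡* (trans (ℤ.*-identityʳ _) (cong (λ z → + p ℤ.* + z) (sym (ℕ.*-identityʳ (suc q))))) ⟩
    ℚᵘ.mkℚᵘ (+ p) 0
      ≈⟨ toℚᵘ-ι p ⟨
    toℚᵘ (ι p) ∎)
    where open ℚᵘ.≃-Reasoning

  1≤ι-suc : ∀ n → 1ℚ ≤ ι (suc n)
  1≤ι-suc n = +-monoˡ-≤ 1ℚ (0≤ι n)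

  ι<ι-suc : ∀ n → ι n < ι (suc n)
  ι<ι-suc n = subst (_< ι (suc n)) (+-identityʳ (ι n)) (ℚ.+-monoʳ-< (ι n) (positive⁻¹ 1ℚ))

  ι*ι-comm : ∀ e c → ι e * ι c ≡ ι (c ℕ.* e)
  ι*ι-comm e c = trans (*-comm (ι e) (ι c)) (sym (ι-* c e))

  ι0*≡ι[*0] : ∀ c x → ι 0 * x ≡ ι (c ℕ.* 0)
  ι0*≡ι[*0] c x = trans (*-zeroˡ x) (cong ι (sym (ℕ.*-zeroʳ c)))

  *ι-cancelʳ : ∀ {x y} n .{{_ : ℕ.NonZero n}} → x * ι n ≡ y * ι n → x ≡ y
  *ι-cancelʳ (suc n) eq = ℚ.≤-antisym (cancel (≤-reflexive eq)) (cancel (≤-reflexive (sym eq)))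
    where
    cancel : ∀ {p q} → p * ι (suc n) ≤ q * ι (suc n) → p ≤ q
    cancel = ℚ.*-cancelʳ-≤-pos (ι (suc n)) {{ℚ.positive (0<ι-suc n)}}

  *-monoˡ-≤-0≤ : ∀ {r p q} → 0ℚ ≤ r → p ≤ q → r * p ≤ r * q
  *-monoˡ-≤-0≤ {r} 0≤r = ℚ.*-monoˡ-≤-nonNeg r {{ℚ.nonNegative 0≤r}}

  *-monoʳ-≤-0≤ : ∀ {r p q} → 0ℚ ≤ r → p ≤ q → p * r ≤ q * r
  *-monoʳ-≤-0≤ {r} 0≤r = ℚ.*-monoʳ-≤-nonNeg r {{ℚ.nonNegative 0≤r}}

  0≤* : ∀ {p q} → 0ℚ ≤ p → 0ℚ ≤ q → 0ℚ ≤ p * q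
  0≤* {p} 0≤p 0≤q = ≤-trans (≤-reflexive (sym (*-zeroʳ p))) (*-monoˡ-≤-0≤ 0≤p 0≤q)

  0≤+ : ∀ {p q} → 0ℚ ≤ p → 0ℚ ≤ q → 0ℚ ≤ p + q
  0≤+ 0≤p 0≤q = +-mono-≤ 0≤p 0≤q

  0≤½ : 0ℚ ≤ ½
  0≤½ = <⇒≤ (positive⁻¹ ½)

  p≤q⇒0≤q-p : ∀ {p q} → p ≤ q → 0ℚ ≤ q - p
  p≤q⇒0≤q-p {p} p≤q = ≤-trans (≤-reflexive (sym (+-inverseʳ p))) (+-monoˡ-≤ (- p) p≤q)

  0≤q⇒p-q≤p : ∀ {p q} → 0ℚ ≤ q → p - q ≤ p
  0≤q⇒p-q≤p {p} 0≤q = ≤-trans (+-monoʳ-≤ p (ℚ.neg-antimono-≤ 0≤q)) (≤-reflexive (+-identityʳ p))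

  p≤q⇒∣p-q∣≡q-p : ∀ {p q} → p ≤ q → ∣ p - q ∣ ≡ q - p
  p≤q⇒∣p-q∣≡q-p {p} {q} p≤q = begin
    ∣ p - q ∣        ≡⟨ cong ∣_∣ (lemma p q) ⟩
    ∣ - (q - p) ∣    ≡⟨ ℚ.∣-p∣≡∣p∣ (q - p) ⟩
    ∣ q - p ∣        ≡⟨ ℚ.0≤p⇒∣p∣≡p (p≤q⇒0≤q-p p≤q) ⟩
    q - p            ∎
    where
    open ≡-Reasoning
    lemma : ∀ p q → p - q ≡ - (q - p)
    lemma = solve 2 (λ p q → p :- q := :- (q :- p)) refl

  archimedean : ∀ p → ∃ λ K → p ≤ ι K
  archimedean p@(mkℚ (+ n) d _) = n , (begin
    p                          ≡⟨ *-identityʳ p ⟨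
    p * 1ℚ                     ≤⟨ *-monoˡ-≤-0≤ (ℚ.nonNegative⁻¹ p) (1≤ι-suc d) ⟩
    p * ι (suc d)              ≡⟨ cong (_* ι (suc d)) (ℚ.↥p/↧p≡p p) ⟨
    (+ n / suc d) * ι (suc d)  ≡⟨ ι-/ n (suc d) ⟩
    ι n                        ∎)
    where open ℚ.≤-Reasoning
  archimedean p@(mkℚ -[1+ n ] d _) = 0 , <⇒≤ (ℚ.negative⁻¹ p)

  -- Lower approximations with error O(1/t)

  record LowerApprox (t : ℕ) (y Y B E : ℚ) : Set where
    field
      nonNeg  : 0ℚ ≤ y
      below   : y ≤ Y
      bounded : Y ≤ B
      error   : ι t * (Y - y) ≤ E

  exact : ∀ {t y B} → 0ℚ ≤ y → y ≤ B → LowerApprox t y y B 0ℚ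
  exact {t} {y} 0≤y y≤B = record
    { nonNeg  = 0≤y
    ; below   = ≤-refl
    ; bounded = y≤B
    ; error   = ≤-reflexive (trans (cong (ι t *_) (+-inverseʳ y)) (*-zeroʳ (ι t)))
    }

  0≤error : ∀ {t y Y B E} → LowerApprox t y Y B E → 0ℚ ≤ E
  0≤error {t} y≈Y = ≤-trans (0≤* (0≤ι t) (p≤q⇒0≤q-p (below y≈Y))) (error y≈Y)
    where open LowerApprox

  LowerApprox-* : ∀ {t y Y p P B K W} → LowerApprox t y Y B K → LowerApprox t p P 1ℚ W →
    LowerApprox t (y * p) (Y * P) B (B * W + K)
  LowerApprox-* {t} {y} {Y} {p} {P} {B} {K} {W} y≈Y p≈P = record
    { nonNeg  = 0≤* 0≤y 0≤p
    ; below   = ≤-trans (*-monoʳ-≤-0≤ 0≤p y≤Y) (*-monoˡ-≤-0≤ 0≤Y p≤P)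
    ; bounded = ≤-trans (*-monoˡ-≤-0≤ 0≤Y P≤1) (≤-trans (≤-reflexive (*-identityʳ Y)) Y≤B)
    ; error   = begin
        ι t * (Y * P - y * p)                     ≡⟨ split (ι t) Y y P p ⟩
        Y * (ι t * (P - p)) + p * (ι t * (Y - y))
          ≤⟨ +-mono-≤ (≤-trans (*-monoˡ-≤-0≤ 0≤Y errP) (*-monoʳ-≤-0≤ (0≤error p≈P) Y≤B))
                      (≤-trans (*-monoʳ-≤-0≤ 0≤errY (≤-trans p≤P P≤1)) (≤-trans (≤-reflexive (*-identityˡ _)) errY)) ⟩
        B * W + K ∎
    }
    where
    open ℚ.≤-Reasoning
    open LowerApprox y≈Y renaming (nonNeg to 0≤y; below to y≤Y; bounded to Y≤B; error to errY)
    open LowerApprox p≈P renaming (nonNeg to 0≤p; below to p≤P; bounded to P≤1; error to errP)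
    0≤Y : 0ℚ ≤ Y
    0≤Y = ≤-trans 0≤y y≤Y
    0≤errY : 0ℚ ≤ ι t * (Y - y)
    0≤errY = 0≤* (0≤ι t) (p≤q⇒0≤q-p y≤Y)
    split : ∀ T Y y P p → T * (Y * P - y * p) ≡ Y * (T * (P - p)) + p * (T * (Y - y))
    split = solve 5 (λ T Y y P p → T :* (Y :* P :- y :* p) := Y :* (T :* (P :- p)) :+ p :* (T :* (Y :- y))) refl

  LowerApprox-+ : ∀ {t u U v V B B′ K K′} → LowerApprox t u U B K → LowerApprox t v V B′ K′ →
    LowerApprox t (u + v) (U + V) (B + B′) (K + K′)
  LowerApprox-+ {t} {u} {U} {v} {V} u≈U v≈V = record
    { nonNeg  = 0≤+ (nonNeg u≈U) (nonNeg v≈V)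
    ; below   = +-mono-≤ (below u≈U) (below v≈V)
    ; bounded = +-mono-≤ (bounded u≈U) (bounded v≈V)
    ; error   = ≤-trans (≤-reflexive (split (ι t) U u V v)) (+-mono-≤ (error u≈U) (error v≈V))
    }
    where
    open LowerApprox
    split : ∀ T U u V v → T * (U + V - (u + v)) ≡ T * (U - u) + T * (V - v)
    split = solve 5 (λ T U u V v → T :* (U :+ V :- (u :+ v)) := T :* (U :- u) :+ T :* (V :- v)) refl

  -- An error of at most E / t after t steps: beyond t = (K + 1)(d + 1), where E ≤ K and
  -- ε ≥ 1 / (d + 1), the error is below ε.
  lowerApprox⇒converges : ∀ {y : ℕ → ℚ} {Y B E} → (∀ t → LowerApprox t (y t) Y B E) →
    ∀ ε → 0ℚ < ε → ∃ λ T → ∀ t → T ℕ.≤ t → ∣ y t - Y ∣ < ε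
  lowerApprox⇒converges {y} {Y} {E = E} y≈Y ε@(mkℚ (+ suc m) d _) 0<ε with archimedean E
  ... | K , E≤K = suc K ℕ.* suc d , close
    where
    ε*ι[1+d] : ε * ι (suc d) ≡ ι (suc m)
    ε*ι[1+d] = trans (cong (_* ι (suc d)) (sym (ℚ.↥p/↧p≡p ε))) (ι-/ (suc m) (suc d))
    close : ∀ t → suc K ℕ.* suc d ℕ.≤ t → ∣ y t - Y ∣ < ε
    close t T≤t = subst (_< ε) (sym (p≤q⇒∣p-q∣≡q-p (LowerApprox.below (y≈Y t))))
      (ℚ.*-cancelˡ-<-nonNeg (ι t) {{ℚ.nonNegative (0≤ι t)}} (begin-strict
        ι t * (Y - y t)                 ≤⟨ LowerApprox.error (y≈Y t) ⟩
        E                               ≤⟨ E≤K ⟩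
        ι K                             <⟨ ι<ι-suc K ⟩
        ι (suc K)                       ≡⟨ *-identityʳ (ι (suc K)) ⟨
        ι (suc K) * 1ℚ                  ≤⟨ *-monoˡ-≤-0≤ (0≤ι (suc K)) (1≤ι-suc m) ⟩
        ι (suc K) * ι (suc m)           ≡⟨ cong (ι (suc K) *_) ε*ι[1+d] ⟨
        ι (suc K) * (ε * ι (suc d))     ≡⟨ regroup (ι (suc K)) ε (ι (suc d)) ⟩
        ι (suc K) * ι (suc d) * ε       ≡⟨ cong (_* ε) (ι-* (suc K) (suc d)) ⟨
        ι (suc K ℕ.* suc d) * ε         ≤⟨ *-monoʳ-≤-0≤ (<⇒≤ 0<ε) (ι-mono-≤ T≤t) ⟩
        ι t * ε                         ∎))
      where
      open ℚ.≤-Reasoning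
      regroup : ∀ k e d → k * (e * d) ≡ k * d * e
      regroup = solve 3 (λ k e d → k :* (e :* d) := k :* d :* e) refl
  lowerApprox⇒converges _ (mkℚ (+ zero) _ _) 0<ε = ⊥-elim (ℤ.<-irrefl refl (ℤ.positive⁻¹ (+ zero) {{ℚ.positive 0<ε}}))
  lowerApprox⇒converges _ (mkℚ -[1+ m ] _ _) 0<ε = ⊥-elim (ℤ.<-asym ℤ.-<+ (ℤ.positive⁻¹ -[1+ m ] {{ℚ.positive 0<ε}}))

  module ExitWithinBudget
    (N : ℕ) (F : ℕ → ℕ → ℚ) (h : ℕ → ℚ)
    (F-start    : ∀ i → suc i ℕ.< N → F 0 (suc i) ≡ 0ℚ)
    (F-step     : ∀ t i → suc i ℕ.< N → F (suc t) (suc i) ≡ ½ * F t (suc (suc i)) + ½ * F t i)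
    (F-left     : ∀ t → F t 0 ≡ h 0)
    (F-right    : ∀ t → F t N ≡ h N)
    (h-harmonic : ∀ i → suc i ℕ.< N → h (suc i) ≡ ½ * h (suc (suc i)) + ½ * h i)
    (0≤h        : ∀ i → i ℕ.≤ N → 0ℚ ≤ h i)
    (h≤1        : ∀ i → i ℕ.≤ N → h i ≤ 1ℚ)
    where

    meanExitTime : ℕ → ℚ
    meanExitTime i = ι i * (ι N - ι i)

    0≤meanExitTime : ∀ i → i ℕ.≤ N → 0ℚ ≤ meanExitTime i
    0≤meanExitTime i i≤N = 0≤* (0≤ι i) (p≤q⇒0≤q-p (ι-mono-≤ i≤N))

    meanExitTime-step : ∀ i → meanExitTime (suc i) ≡ ½ * meanExitTime (suc (suc i)) + ½ * meanExitTime i + 1ℚ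
    meanExitTime-step i = lemma (ι i) (ι N)
      where
      lemma : ∀ x n → (x + 1ℚ) * (n - (x + 1ℚ))
                      ≡ ½ * ((x + 1ℚ + 1ℚ) * (n - (x + 1ℚ + 1ℚ))) + ½ * (x * (n - x)) + 1ℚ
      lemma = solve 2 (λ x n → (x :+ con 1ℚ) :* (n :- (x :+ con 1ℚ))
                               := con ½ :* ((x :+ con 1ℚ :+ con 1ℚ) :* (n :- (x :+ con 1ℚ :+ con 1ℚ)))
                                  :+ con ½ :* (x :* (n :- x)) :+ con 1ℚ) refl

    error-step : ∀ T H f H′ f′ → (T + 1ℚ) * ((½ * H + ½ * H′) - (½ * f + ½ * f′))
                                  ≡ ½ * (T * (H - f)) + ½ * (T * (H′ - f′)) + (½ * (H - f) + ½ * (H′ - f′))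
    error-step = solve 5 (λ T H f H′ f′ →
                   (T :+ con 1ℚ) :* ((con ½ :* H :+ con ½ :* H′) :- (con ½ :* f :+ con ½ :* f′))
                   := con ½ :* (T :* (H :- f)) :+ con ½ :* (T :* (H′ :- f′))
                      :+ (con ½ :* (H :- f) :+ con ½ :* (H′ :- f′))) refl

    approximates-end : ∀ t i → i ℕ.≤ N → F t i ≡ h i → LowerApprox t (F t i) (h i) 1ℚ (meanExitTime i)
    approximates-end t i i≤N Fti≡hi rewrite Fti≡hi = record
      { nonNeg  = 0≤h i i≤N
      ; below   = ≤-refl
      ; bounded = h≤1 i i≤N
      ; error   = ≤-trans (≤-reflexive (trans (cong (ι t *_) (+-inverseʳ (h i))) (*-zeroʳ (ι t))))
                          (0≤meanExitTime i i≤N)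
      }

    approximates : ∀ t i → i ℕ.≤ N → LowerApprox t (F t i) (h i) 1ℚ (meanExitTime i)
    approximates-interior : ∀ t i → suc i ℕ.< N → LowerApprox t (F t (suc i)) (h (suc i)) 1ℚ (meanExitTime (suc i))

    approximates t zero    0≤N = approximates-end t 0 0≤N (F-left t)
    approximates t (suc i) i<N with suc i ℕ.≟ N
    ... | yes refl = approximates-end t (suc i) i<N (F-right t)
    ... | no  i≢N  = approximates-interior t i (ℕ.≤∧≢⇒< i<N i≢N)

    approximates-interior zero i i<N rewrite F-start i i<N = record
      { nonNeg  = ≤-refl
      ; below   = 0≤h (suc i) (ℕ.<⇒≤ i<N)
      ; bounded = h≤1 (suc i) (ℕ.<⇒≤ i<N)
      ; error   = ≤-trans (≤-reflexive (*-zeroˡ (h (suc i) - 0ℚ))) (0≤meanExitTime (suc i) (ℕ.<⇒≤ i<N))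
      }
    approximates-interior (suc t) i i<N rewrite F-step t i i<N = record
      { nonNeg  = 0≤+ (0≤* 0≤½ 0≤f) (0≤* 0≤½ 0≤f′)
      ; below   = ≤-trans (+-mono-≤ (*-monoˡ-≤-0≤ 0≤½ f≤H) (*-monoˡ-≤-0≤ 0≤½ f′≤H′))
                          (≤-reflexive (sym (h-harmonic i i<N)))
      ; bounded = h≤1 (suc i) (ℕ.<⇒≤ i<N)
      ; error   = begin
        ι (suc t) * (h (suc i) - (½ * f + ½ * f′))
          ≡⟨ cong (λ x → ι (suc t) * (x - (½ * f + ½ * f′))) (h-harmonic i i<N) ⟩
        ι (suc t) * ((½ * H + ½ * H′) - (½ * f + ½ * f′))
          ≡⟨ error-step (ι t) H f H′ f′ ⟩
        ½ * (ι t * (H - f)) + ½ * (ι t * (H′ - f′)) + (½ * (H - f) + ½ * (H′ - f′))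
          ≤⟨ +-mono-≤ (+-mono-≤ (*-monoˡ-≤-0≤ 0≤½ err) (*-monoˡ-≤-0≤ 0≤½ err′))
                      (+-mono-≤ (*-monoˡ-≤-0≤ 0≤½ (≤-trans (0≤q⇒p-q≤p 0≤f) H≤1))
                                (*-monoˡ-≤-0≤ 0≤½ (≤-trans (0≤q⇒p-q≤p 0≤f′) H′≤1))) ⟩
        ½ * meanExitTime (suc (suc i)) + ½ * meanExitTime i + (½ * 1ℚ + ½ * 1ℚ)
          ≡⟨ meanExitTime-step i ⟨
        meanExitTime (suc i) ∎
      }
      where
      open ℚ.≤-Reasoning
      f = F t (suc (suc i))
      f′ = F t i
      H = h (suc (suc i))
      H′ = h i
      open LowerApprox (approximates t (suc (suc i)) i<N)
        renaming (nonNeg to 0≤f; below to f≤H; bounded to H≤1; error to err)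
      open LowerApprox (approximates t i (ℕ.≤-trans (ℕ.n≤1+n i) (ℕ.<⇒≤ i<N)))
        renaming (nonNeg to 0≤f′; below to f′≤H′; bounded to H′≤1; error to err′)

  -- Gambler's ruin

  exitTime : ℕ → ℕ → ℚ
  exitTime a b = ι (suc a) * ι (suc b)

  exitRight∞ exitLeft∞ : ℕ → ℕ → ℚ
  exitRight∞ a b = + suc a / suc (suc (a ℕ.+ b))
  exitLeft∞  a b = + suc b / suc (suc (a ℕ.+ b))

  -- Site i ∈ {0, …, N} of the walk is the integer i − (a + 1): the occupied interval {−a, …, b}
  -- is the interior 1, …, N − 1, and the walk stops at 0 (exit left) or N (exit right).
  module GamblersRuin (a b : ℕ) where

    N : ℕ
    N = suc (suc (a ℕ.+ b))

    site : ℕ → ℤ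
    site i = + i ℤ.- + suc a

    site-suc : ∀ i → site i ℤ.+ + 1 ≡ site (suc i)
    site-suc i = lemma (+ i) (+ a)
      where
      lemma : ∀ x y → (x ℤ.- (+ 1 ℤ.+ y)) ℤ.+ + 1 ≡ (+ 1 ℤ.+ x) ℤ.- (+ 1 ℤ.+ y)
      lemma = solve-∀

    site-pred : ∀ i → site (suc i) ℤ.- + 1 ≡ site i
    site-pred i = lemma (+ i) (+ a)
      where
      lemma : ∀ x y → ((+ 1 ℤ.+ x) ℤ.- (+ 1 ℤ.+ y)) ℤ.- + 1 ≡ x ℤ.- (+ 1 ℤ.+ y)
      lemma = solve-∀

    site-origin : site (suc a) ≡ + 0
    site-origin = ℤ.+-inverseʳ (+ suc a)

    site-N : site N ≡ + suc b
    site-N = lemma (+ a) (+ b)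
      where
      lemma : ∀ x y → (+ 1 ℤ.+ (+ 1 ℤ.+ (x ℤ.+ y))) ℤ.- (+ 1 ℤ.+ x) ≡ + 1 ℤ.+ y
      lemma = solve-∀

    site-≤ : ∀ i → suc i ℕ.≤ N → site i ℤ.≤ + b
    site-≤ i (s≤s i≤) = subst (site i ℤ.≤_) (lemma (+ a) (+ b)) (ℤ.+-monoˡ-≤ (ℤ.- + suc a) (ℤ.+≤+ i≤))
      where
      lemma : ∀ x y → (+ 1 ℤ.+ (x ℤ.+ y)) ℤ.- (+ 1 ℤ.+ x) ≡ y
      lemma = solve-∀

    site-≥ : ∀ i → 1 ℕ.≤ i → ℤ.- (+ a) ℤ.≤ site i
    site-≥ i 1≤i = subst (ℤ._≤ site i) (lemma (+ a)) (ℤ.+-monoˡ-≤ (ℤ.- + suc a) (ℤ.+≤+ 1≤i))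
      where
      lemma : ∀ x → + 1 ℤ.- (+ 1 ℤ.+ x) ≡ ℤ.- x
      lemma = solve-∀

    module _ (i : ℕ) (i<N : suc i ℕ.< N) where
      private
        inside-right : ¬ (+ b ℤ.< site (suc i))
        inside-right = ℤ.≤⇒≯ (site-≤ (suc i) i<N)
        inside-left : ¬ (site (suc i) ℤ.< ℤ.- (+ a))
        inside-left = ℤ.≤⇒≯ (site-≥ (suc i) (s≤s z≤n))

      exitRight-start : exitRight 0 a b (site (suc i)) ≡ 0ℚ
      exitRight-start rewrite dec-false (+ b ℤ.<? site (suc i)) inside-right
                            | dec-false (site (suc i) ℤ.<? ℤ.- (+ a)) inside-left = refl

      exitLeft-start : exitLeft 0 a b (site (suc i)) ≡ 0ℚ
      exitLeft-start rewrite dec-false (+ b ℤ.<? site (suc i)) inside-right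
                           | dec-false (site (suc i) ℤ.<? ℤ.- (+ a)) inside-left = refl

      exitRight-step : ∀ t → exitRight (suc t) a b (site (suc i))
                               ≡ ½ * exitRight t a b (site (suc (suc i))) + ½ * exitRight t a b (site i)
      exitRight-step t rewrite dec-false (+ b ℤ.<? site (suc i)) inside-right
                             | dec-false (site (suc i) ℤ.<? ℤ.- (+ a)) inside-left
                             | site-suc (suc i) | site-pred i = refl

      exitLeft-step : ∀ t → exitLeft (suc t) a b (site (suc i))
                              ≡ ½ * exitLeft t a b (site (suc (suc i))) + ½ * exitLeft t a b (site i)
      exitLeft-step t rewrite dec-false (+ b ℤ.<? site (suc i)) inside-right
                            | dec-false (site (suc i) ℤ.<? ℤ.- (+ a)) inside-left
                            | site-suc (suc i) | site-pred i = refl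

    private
      left-of-b : ¬ (+ b ℤ.< -[1+ a ])
      left-of-b b<-a-1 = ℤ.<-asym b<-a-1 ℤ.-<+

      -[1+n]<-n : ∀ n → -[1+ n ] ℤ.< ℤ.- (+ n)
      -[1+n]<-n zero    = ℤ.-<+
      -[1+n]<-n (suc n) = ℤ.-<- (ℕ.n<1+n n)

      left-of-−a : -[1+ a ] ℤ.< ℤ.- (+ a)
      left-of-−a = -[1+n]<-n a

      right-of-b : + b ℤ.< + suc b
      right-of-b = ℤ.+<+ (ℕ.n<1+n b)

      right-of-−a : ¬ (+ suc b ℤ.< ℤ.- (+ a))
      right-of-−a = ℤ.≤⇒≯ (ℤ.≤-trans (ℤ.neg-≤-pos {a} {0}) (ℤ.+≤+ z≤n))

    exitRight-left : ∀ t → exitRight t a b (site 0) ≡ 0ℚ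
    exitRight-left t rewrite dec-false (+ b ℤ.<? -[1+ a ]) left-of-b
                           | dec-true (-[1+ a ] ℤ.<? ℤ.- (+ a)) left-of-−a = refl

    exitRight-right : ∀ t → exitRight t a b (site N) ≡ 1ℚ
    exitRight-right t rewrite site-N | dec-true (+ b ℤ.<? + suc b) right-of-b = refl

    exitLeft-left : ∀ t → exitLeft t a b (site 0) ≡ 1ℚ
    exitLeft-left t rewrite dec-true (-[1+ a ] ℤ.<? ℤ.- (+ a)) left-of-−a = refl

    exitLeft-right : ∀ t → exitLeft t a b (site N) ≡ 0ℚ
    exitLeft-right t rewrite site-N | dec-false (+ suc b ℤ.<? ℤ.- (+ a)) right-of-−a
                           | dec-true (+ b ℤ.<? + suc b) right-of-b = refl

    1/N : ℚ
    1/N = + 1 / N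

    0≤1/N : 0ℚ ≤ 1/N
    0≤1/N = ℚ.nonNegative⁻¹ 1/N {{ℚ.normalize-nonNeg 1 N}}

    ιN*1/N : ι N * 1/N ≡ 1ℚ
    ιN*1/N = trans (*-comm (ι N) 1/N) (ι-/ 1 N)

    hitRight hitLeft : ℕ → ℚ
    hitRight i = ι i * 1/N
    hitLeft  i = 1ℚ - hitRight i

    hitRight-harmonic : ∀ i → suc i ℕ.< N → hitRight (suc i) ≡ ½ * hitRight (suc (suc i)) + ½ * hitRight i
    hitRight-harmonic i _ = lemma (ι i) 1/N
      where
      lemma : ∀ x c → (x + 1ℚ) * c ≡ ½ * ((x + 1ℚ + 1ℚ) * c) + ½ * (x * c)
      lemma = solve 2 (λ x c → (x :+ con 1ℚ) :* c
                               := con ½ :* ((x :+ con 1ℚ :+ con 1ℚ) :* c) :+ con ½ :* (x :* c)) refl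

    hitLeft-harmonic : ∀ i → suc i ℕ.< N → hitLeft (suc i) ≡ ½ * hitLeft (suc (suc i)) + ½ * hitLeft i
    hitLeft-harmonic i _ = lemma (ι i) 1/N
      where
      lemma : ∀ x c → 1ℚ - (x + 1ℚ) * c ≡ ½ * (1ℚ - (x + 1ℚ + 1ℚ) * c) + ½ * (1ℚ - x * c)
      lemma = solve 2 (λ x c → con 1ℚ :- (x :+ con 1ℚ) :* c
                               := con ½ :* (con 1ℚ :- (x :+ con 1ℚ :+ con 1ℚ) :* c) :+ con ½ :* (con 1ℚ :- x :* c)) refl

    0≤hitRight : ∀ i → i ℕ.≤ N → 0ℚ ≤ hitRight i
    0≤hitRight i _ = 0≤* (0≤ι i) 0≤1/N

    hitRight≤1 : ∀ i → i ℕ.≤ N → hitRight i ≤ 1ℚ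
    hitRight≤1 i i≤N = ≤-trans (*-monoʳ-≤-0≤ 0≤1/N (ι-mono-≤ i≤N)) (≤-reflexive ιN*1/N)

    0≤hitLeft : ∀ i → i ℕ.≤ N → 0ℚ ≤ hitLeft i
    0≤hitLeft i i≤N = p≤q⇒0≤q-p (hitRight≤1 i i≤N)

    hitLeft≤1 : ∀ i → i ℕ.≤ N → hitLeft i ≤ 1ℚ
    hitLeft≤1 i i≤N = 0≤q⇒p-q≤p (0≤hitRight i i≤N)

    module Right = ExitWithinBudget N (λ t i → exitRight t a b (site i)) hitRight
      exitRight-start (λ t i i<N → exitRight-step i i<N t)
      (λ t → trans (exitRight-left t) (sym (*-zeroˡ 1/N))) (λ t → trans (exitRight-right t) (sym ιN*1/N))
      hitRight-harmonic 0≤hitRight hitRight≤1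

    module Left = ExitWithinBudget N (λ t i → exitLeft t a b (site i)) hitLeft
      exitLeft-start (λ t i i<N → exitLeft-step i i<N t)
      (λ t → trans (exitLeft-left t) (cong (λ x → 1ℚ - x) (sym (*-zeroˡ 1/N))))
      (λ t → trans (exitLeft-right t) (cong (λ x → 1ℚ - x) (sym ιN*1/N)))
      hitLeft-harmonic 0≤hitLeft hitLeft≤1

    a+1≤N : suc a ℕ.≤ N
    a+1≤N = s≤s (ℕ.≤-trans (ℕ.m≤m+n a b) (ℕ.n≤1+n _))

    ιN-ι[a+1] : ι N - ι (suc a) ≡ ι (suc b)
    ιN-ι[a+1] = begin
      ι N - ι (suc a)                ≡⟨ cong (λ n → ι n - ι (suc a)) (cong suc (ℕ.+-suc a b)) ⟨
      ι (suc a ℕ.+ suc b) - ι (suc a) ≡⟨ cong (_- ι (suc a)) (ι-+ (suc a) (suc b)) ⟩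
      ι (suc a) + ι (suc b) - ι (suc a) ≡⟨ lemma (ι (suc a)) (ι (suc b)) ⟩
      ι (suc b)                      ∎
      where
      open ≡-Reasoning
      lemma : ∀ x y → x + y - x ≡ y
      lemma = solve 2 (λ x y → x :+ y :- x := y) refl

    meanExitTime-origin : Right.meanExitTime (suc a) ≡ exitTime a b
    meanExitTime-origin = cong (ι (suc a) *_) ιN-ι[a+1]

    hitRight-origin : hitRight (suc a) ≡ exitRight∞ a b
    hitRight-origin = *ι-cancelʳ N (begin
      ι (suc a) * 1/N * ι N      ≡⟨ *-assoc (ι (suc a)) 1/N (ι N) ⟩
      ι (suc a) * (1/N * ι N)    ≡⟨ cong (ι (suc a) *_) (trans (*-comm 1/N (ι N)) ιN*1/N) ⟩
      ι (suc a) * 1ℚ             ≡⟨ *-identityʳ (ι (suc a)) ⟩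
      ι (suc a)                  ≡⟨ ι-/ (suc a) N ⟨
      exitRight∞ a b * ι N       ∎)
      where open ≡-Reasoning

    hitLeft-origin : hitLeft (suc a) ≡ exitLeft∞ a b
    hitLeft-origin = *ι-cancelʳ N (begin
      (1ℚ - ι (suc a) * 1/N) * ι N    ≡⟨ lemma (ι (suc a)) 1/N (ι N) ⟩
      ι N - ι (suc a) * (ι N * 1/N)   ≡⟨ cong (λ x → ι N - ι (suc a) * x) ιN*1/N ⟩
      ι N - ι (suc a) * 1ℚ            ≡⟨ cong (λ x → ι N - x) (*-identityʳ (ι (suc a))) ⟩
      ι N - ι (suc a)                 ≡⟨ ιN-ι[a+1] ⟩
      ι (suc b)                       ≡⟨ ι-/ (suc b) N ⟨
      exitLeft∞ a b * ι N             ∎)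
      where
      open ≡-Reasoning
      lemma : ∀ x c n → (1ℚ - x * c) * n ≡ n - x * (n * c)
      lemma = solve 3 (λ x c n → (con 1ℚ :- x :* c) :* n := n :- x :* (n :* c)) refl

  exitRight-approx : ∀ t a b → LowerApprox t (exitRight t a b (+ 0)) (exitRight∞ a b) 1ℚ (exitTime a b)
  exitRight-approx t a b =
    subst (λ x → LowerApprox t (exitRight t a b x) (exitRight∞ a b) 1ℚ (exitTime a b)) site-origin
      (subst₂ (λ Y E → LowerApprox t (exitRight t a b (site (suc a))) Y 1ℚ E) hitRight-origin meanExitTime-origin
        (Right.approximates t (suc a) a+1≤N))
    where open GamblersRuin a b

  exitLeft-approx : ∀ t a b → LowerApprox t (exitLeft t a b (+ 0)) (exitLeft∞ a b) 1ℚ (exitTime a b)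
  exitLeft-approx t a b =
    subst (λ x → LowerApprox t (exitLeft t a b x) (exitLeft∞ a b) 1ℚ (exitTime a b)) site-origin
      (subst₂ (λ Y E → LowerApprox t (exitLeft t a b (site (suc a))) Y 1ℚ E) hitLeft-origin meanExitTime-origin
        (Left.approximates t (suc a) a+1≤N))
    where open GamblersRuin a b

  -- The IDLA recursion and its limit

  -- idla∞ j b is the paper's P(j + 1, b), the limit of idla t j b as t → ∞.
  idla∞ : ℕ → ℕ → ℚ
  idla∞ zero    zero    = 1ℚ
  idla∞ zero    (suc b) = 0ℚ
  idla∞ (suc j) zero    = idla∞ j zero * exitLeft∞ j zero
  idla∞ (suc j) (suc b) = idla∞ j (suc b) * exitLeft∞ (j ∸ suc b) (suc b) + idla∞ j b * exitRight∞ (j ∸ b) b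

  massBound : ℕ → ℕ → ℚ
  massBound zero    zero    = 1ℚ
  massBound zero    (suc b) = 0ℚ
  massBound (suc j) zero    = massBound j zero
  massBound (suc j) (suc b) = massBound j (suc b) + massBound j b

  errorBound : ℕ → ℕ → ℚ
  errorBound zero    _       = 0ℚ
  errorBound (suc j) zero    = massBound j zero * exitTime j zero + errorBound j zero
  errorBound (suc j) (suc b) =
    (massBound j (suc b) * exitTime (j ∸ suc b) (suc b) + errorBound j (suc b))
    + (massBound j b * exitTime (j ∸ b) b + errorBound j b)

  idla-approx : ∀ t j b → LowerApprox t (idla t j b) (idla∞ j b) (massBound j b) (errorBound j b)
  idla-approx t zero    zero    = exact (<⇒≤ (positive⁻¹ 1ℚ)) ≤-refl
  idla-approx t zero    (suc b) = exact ≤-refl ≤-refl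
  idla-approx t (suc j) zero    = LowerApprox-* (idla-approx t j zero) (exitLeft-approx t j zero)
  idla-approx t (suc j) (suc b) =
    LowerApprox-+ (LowerApprox-* (idla-approx t j (suc b)) (exitLeft-approx t (j ∸ suc b) (suc b)))
                  (LowerApprox-* (idla-approx t j b) (exitRight-approx t (j ∸ b) b))

  exitLeft∞-scaled : ∀ {a b j} → a ℕ.+ b ≡ j → exitLeft∞ a b * ι (suc (suc j)) ≡ ι (suc b)
  exitLeft∞-scaled {b = b} refl = ι-/ (suc b) _

  exitRight∞-scaled : ∀ {a b j} → a ℕ.+ b ≡ j → exitRight∞ a b * ι (suc (suc j)) ≡ ι (suc a)
  exitRight∞-scaled {a} refl = ι-/ (suc a) _

  -- Past the occupied interval (b ≥ j) the parameters j ∸ suc b and j ∸ b are truncated and the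
  -- exit probabilities meaningless, but there the Eulerian number in front vanishes.
  exitLeft-term : ∀ j b → ι (eulerianRec (suc j) (suc b)) * (exitLeft∞ (j ∸ suc b) (suc b) * ι (suc (suc j)))
                           ≡ ι (suc (suc b) ℕ.* eulerianRec (suc j) (suc b))
  exitLeft-term j b with suc b ℕ.≤? j
  ... | yes b<j = trans (cong (ι (eulerianRec (suc j) (suc b)) *_) (exitLeft∞-scaled {j ∸ suc b} (ℕ.m∸n+n≡m b<j)))
                        (ι*ι-comm (eulerianRec (suc j) (suc b)) (suc (suc b)))
  ... | no  b≮j rewrite eulerianRec-vanishes (suc j) b (ℕ.≰⇒> b≮j) =
    ι0*≡ι[*0] (suc (suc b)) (exitLeft∞ (j ∸ suc b) (suc b) * ι (suc (suc j)))

  exitRight-term : ∀ j b → ι (eulerianRec (suc j) b) * (exitRight∞ (j ∸ b) b * ι (suc (suc j)))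
                            ≡ ι ((suc j ∸ b) ℕ.* eulerianRec (suc j) b)
  exitRight-term j b with b ℕ.≤? j
  ... | yes b≤j = trans (cong (ι (eulerianRec (suc j) b) *_) (trans (exitRight∞-scaled {j ∸ b} (ℕ.m∸n+n≡m b≤j))
                                                                     (cong ι (sym (ℕ.+-∸-assoc 1 b≤j)))))
                        (ι*ι-comm (eulerianRec (suc j) b) (suc j ∸ b))
  exitRight-term j zero    | no b≰j = ⊥-elim (b≰j z≤n)
  exitRight-term j (suc b) | no b≰j rewrite eulerianRec-vanishes (suc j) b (ℕ.≰⇒> b≰j) =
    ι0*≡ι[*0] (j ∸ b) (exitRight∞ (j ∸ suc b) (suc b) * ι (suc (suc j)))

  idla∞-scaled : ∀ j b → idla∞ j b * ι (suc j !) ≡ ι (eulerianRec (suc j) b)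
  idla∞-scaled zero    zero    = refl
  idla∞-scaled zero    (suc b) = trans (*-zeroˡ (ι 1)) (cong ι (sym (eulerianRec-vanishes 1 b (s≤s z≤n))))
  idla∞-scaled (suc j) zero    = begin
    idla∞ j 0 * exitLeft∞ j 0 * ι (suc (suc j) !)
      ≡⟨ cong (idla∞ j 0 * exitLeft∞ j 0 *_) (ι-* (suc (suc j)) (suc j !)) ⟩
    idla∞ j 0 * exitLeft∞ j 0 * (ι (suc (suc j)) * ι (suc j !))
      ≡⟨ regroup (idla∞ j 0) (exitLeft∞ j 0) (ι (suc (suc j))) (ι (suc j !)) ⟩
    idla∞ j 0 * ι (suc j !) * (exitLeft∞ j 0 * ι (suc (suc j)))
      ≡⟨ cong₂ _*_ (idla∞-scaled j 0) (exitLeft∞-scaled {j} {0} (ℕ.+-identityʳ j)) ⟩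
    ι (eulerianRec (suc j) 0) * 1ℚ
      ≡⟨ *-identityʳ _ ⟩
    ι (eulerianRec (suc j) 0)
      ∎
    where
    open ≡-Reasoning
    regroup : ∀ q p x y → q * p * (x * y) ≡ q * y * (p * x)
    regroup = solve 4 (λ q p x y → q :* p :* (x :* y) := q :* y :* (p :* x)) refl
  idla∞-scaled (suc j) (suc b) = begin
    (Q₁ * P₁ + Q₀ * P₀) * ι (suc (suc j) !)
      ≡⟨ cong ((Q₁ * P₁ + Q₀ * P₀) *_) (ι-* (suc (suc j)) (suc j !)) ⟩
    (Q₁ * P₁ + Q₀ * P₀) * (ι (suc (suc j)) * ι (suc j !))
      ≡⟨ regroup Q₁ P₁ Q₀ P₀ (ι (suc (suc j))) (ι (suc j !)) ⟩
    Q₁ * ι (suc j !) * (P₁ * ι (suc (suc j))) + Q₀ * ι (suc j !) * (P₀ * ι (suc (suc j)))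
      ≡⟨ cong₂ _+_ (cong (_* (P₁ * ι (suc (suc j)))) (idla∞-scaled j (suc b)))
                   (cong (_* (P₀ * ι (suc (suc j)))) (idla∞-scaled j b)) ⟩
    ι (eulerianRec (suc j) (suc b)) * (P₁ * ι (suc (suc j))) + ι (eulerianRec (suc j) b) * (P₀ * ι (suc (suc j)))
      ≡⟨ cong₂ _+_ (exitLeft-term j b) (exitRight-term j b) ⟩
    ι (suc (suc b) ℕ.* eulerianRec (suc j) (suc b)) + ι ((suc j ∸ b) ℕ.* eulerianRec (suc j) b)
      ≡⟨ ι-+ (suc (suc b) ℕ.* eulerianRec (suc j) (suc b)) ((suc j ∸ b) ℕ.* eulerianRec (suc j) b) ⟨
    ι (eulerianRec (suc (suc j)) (suc b))
      ∎
    where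
    open ≡-Reasoning
    Q₁ = idla∞ j (suc b)
    Q₀ = idla∞ j b
    P₁ = exitLeft∞ (j ∸ suc b) (suc b)
    P₀ = exitRight∞ (j ∸ b) b
    regroup : ∀ q₁ p₁ q₀ p₀ x y → (q₁ * p₁ + q₀ * p₀) * (x * y) ≡ q₁ * y * (p₁ * x) + q₀ * y * (p₀ * x)
    regroup = solve 6 (λ q₁ p₁ q₀ p₀ x y → (q₁ :* p₁ :+ q₀ :* p₀) :* (x :* y)
                                           := q₁ :* y :* (p₁ :* x) :+ q₀ :* y :* (p₀ :* x)) refl

  idla∞≡eulerianRatio : ∀ j b → idla∞ j b ≡ eulerianRatio (suc j) b
  idla∞≡eulerianRatio j b = *ι-cancelʳ (suc j !) {{suc j ℕ.!≢0}} (begin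
    idla∞ j b * ι (suc j !)                 ≡⟨ idla∞-scaled j b ⟩
    ι (eulerianRec (suc j) b)               ≡⟨ cong ι (eulerian≡eulerianRec (suc j) b) ⟨
    ι (eulerian (suc j) b)                  ≡⟨ ι-/ (eulerian (suc j) b) (suc j !) {{suc j ℕ.!≢0}} ⟨
    eulerianRatio (suc j) b * ι (suc j !)   ∎)
    where open ≡-Reasoning

open IdlaLimit using (LowerApprox; idla∞≡eulerianRatio; idla-approx; massBound; errorBound; lowerApprox⇒converges)
open import Data.Nat using (_≤_; _<_)
open import Data.Rational using (_-_) renaming (_<_ to _<ℚ_)

theorem1 : (n k : ℕ) → 1 ≤ n → k < n →
    (ε : ℚ) → 0ℚ <ℚ ε →
    ∃ λ (T : ℕ) → (t : ℕ) → T ≤ t →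
      ∣ idla t (n ∸ 1) k - eulerianRatio n k ∣ <ℚ ε
theorem1 zero    k ()  _
theorem1 (suc j) k _ _ = lowerApprox⇒converges λ t →
  subst (λ Y → LowerApprox t (idla t j k) Y (massBound j k) (errorBound j k))
        (idla∞≡eulerianRatio j k) (idla-approx t j k)
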